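{- Let $(G_n)$ be a sequence of graphs, where $G_n$ has $n$ vertices, $\alpha(G_n)\le 2$, and $G_n$ minimizes the number of $4$-cliques among all $n$-vertex graphs with independence number at most $2$. Suppose that for each $n$ the vertex set is partitioned as $V(G_n)=V_1\cup\dots\cup V_5\cup U$ (indices of the $V_i$ modulo $5$) such that, for some function $h(n)=o(n)$: for every $i$ and every $v\in V_i$, $v$ is adjacent to all but at most $h(n)$ vertices of $V_{i-1}\cup V_i\cup V_{i+1}$ and has at most $h(n)$ neighbours in $V_{i+2}\cup V_{i+3}$; $V_i\cup V_{i+1}$ is a clique for every $i$; $|V_i|=\frac n5+o(n)$ for every $i$; and $|U|=o(n)$. Then there is a function $g(n)=o(n)$ such that for all sufficiently large $n$ and every $u\in U$ there is an index $i=i(u)$ with $V_{i-1}\cup V_i\cup V_{i+1}\subseteq N(u)$ and $u$ having at most $g(n)$ neighbours in $V_{i+2}\cup V_{i+3}$.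
   Context: $\alpha(G)$ is the independence number and $N(u)$ the neighbourhood of a vertex $u$. -}

module Defs where

open import Data.Nat using (ℕ; _+_; _*_; _≤_; _<ᵇ_)
open import Data.Nat.DivMod using (_mod_)
open import Data.Fin using (Fin; toℕ)
open import Data.Fin.Subset using (Subset; _∈_; ∣_∣)
open import Data.Bool using (Bool; true; false; _∧_; not; if_then_else_)
open import Data.List using (List; []; _∷_; allFin; filterᵇ; length; map)
open import Data.Nat.ListAction using (sum)
open import Data.Bool.ListAction using (any)
open import Data.Maybe using (Maybe; just; nothing)
open import Data.Product using (∃)
open import Relation.Binary.PropositionalEquality using (_≡_; _≢_)
open import Relation.Nullary.Decidable using (⌊_⌋)
import Data.Fin as F

record Graph (n : ℕ) : Set where
  field
    adj    : Fin n → Fin n → Bool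
    sym    : ∀ x y → adj x y ≡ adj y x
    irrefl : ∀ x → adj x x ≡ false
open Graph public

count : ∀ {n} → (Fin n → Bool) → ℕ
count {n} p = length (filterᵇ p (allFin n))

sumFin : ∀ {n} → (Fin n → ℕ) → ℕ
sumFin {n} f = sum (map f (allFin n))

_<F_ : ∀ {n} → Fin n → Fin n → Bool
a <F b = toℕ a <ᵇ toℕ b

_==F_ : ∀ {n} → Fin n → Fin n → Bool
a ==F b = ⌊ a F.≟ b ⌋

K4count : ∀ {n} → Graph n → ℕ
K4count {n} G = sumFin λ a → sumFin λ b → sumFin λ c → count λ d →
  (a <F b) ∧ (b <F c) ∧ (c <F d) ∧
  adj G a b ∧ adj G a c ∧ adj G a d ∧ adj G b c ∧ adj G b d ∧ adj G c d

Independent : ∀ {n} → Graph n → Subset n → Set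
Independent G S = ∀ x y → x ∈ S → y ∈ S → adj G x y ≡ false

AlphaAtMost2 : ∀ {n} → Graph n → Set
AlphaAtMost2 {n} G = ∀ (S : Subset n) → Independent G S → ∣ S ∣ ≤ 2

K4Minimizer : ∀ {n} → Graph n → Set
K4Minimizer {n} G = ∀ (H : Graph n) → AlphaAtMost2 H → K4count G ≤ K4count H

LittleO : (ℕ → ℕ) → Set
LittleO f = ∀ (k : ℕ) → ∃ λ N → ∀ n → N ≤ n → k * f n ≤ n

shift : Fin 5 → ℕ → Fin 5
shift i k = (toℕ i + k) mod 5

-- a partition label: just i means V_i, nothing means U
Label : Set
Label = Maybe (Fin 5)

inIdx : Label → List (Fin 5) → Bool
inIdx nothing  is = false
inIdx (just j) is = any (λ i → j ==F i) is

near : Fin 5 → List (Fin 5)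
near i = shift i 4 ∷ i ∷ shift i 1 ∷ []

far : Fin 5 → List (Fin 5)
far i = shift i 2 ∷ shift i 3 ∷ []

DegreeCond : ∀ {n} → Graph n → (Fin n → Label) → ℕ → Set
DegreeCond {n} G part h = ∀ (i : Fin 5) (v : Fin n) → part v ≡ just i →
  (count (λ w → inIdx (part w) (near i) ∧ not (adj G v w) ∧ not (w ==F v)) ≤ h)
  × (count (λ w → inIdx (part w) (far i) ∧ adj G v w) ≤ h)
  where open import Data.Product using (_×_)

CliqueCond : ∀ {n} → Graph n → (Fin n → Label) → Set
CliqueCond {n} G part = ∀ (i : Fin 5) (v w : Fin n) → v ≢ w →
  inIdx (part v) (i ∷ shift i 1 ∷ []) ≡ true →
  inIdx (part w) (i ∷ shift i 1 ∷ []) ≡ true → adj G v w ≡ true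

SizeCond : ∀ {n} → (Fin n → Label) → ℕ → Set
SizeCond {n} part s = ∀ (i : Fin 5) →
  (5 * count (λ w → inIdx (part w) (i ∷ [])) ≤ n + 5 * s)
  × (n ≤ 5 * count (λ w → inIdx (part w) (i ∷ [])) + 5 * s)
  where open import Data.Product using (_×_)

isU : Label → Bool
isU nothing  = true
isU (just _) = false

USizeCond : ∀ {n} → (Fin n → Label) → ℕ → Set
USizeCond part t = count (λ w → isU (part w)) ≤ t

module Submission where

-- Fix u ∈ U. As α(G) ≤ 2, the non-neighbours of u form a clique, so a non-neighbour of u in V_k is
-- adjacent to every non-neighbour of u in V_{k+2} ∪ V_{k+3}; by the degree condition, going around
-- the 5-cycle gives a j such that u misses at most 2h vertices of V_{j+2} ∪ V_{j+3} ∪ V_{j+4}.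
-- Rewiring u to be adjacent exactly to the vertices outside the clique V_j ∪ V_{j+1} keeps α ≤ 2,
-- so by minimality the number of K4s through u does not drop. The rewiring destroys every K4 u b c d
-- with b a neighbour of u in V_j and c, d neighbours in V_{j+4} (similarly for V_{j+1} and V_{j+2}),
-- while every K4 it creates uses one of at most 2h + |U| new neighbours of u. As u sees almost all
-- of V_{j+4} and V_{j+2}, it has O(h + |U|) neighbours in V_j ∪ V_{j+1}, so it misses more than h
-- vertices of each, which excludes any non-neighbour in V_{j+2} ∪ V_{j+3} ∪ V_{j+4}: take i = j + 3.
-- K4s are counted as sorted 4-tuples; those through u correspond to sorted triples of its link,
-- and counting ordered triples instead costs at most a factor 6.

open import Defs hiding (sym)
open import Data.Nat using (ℕ; zero; suc; _+_; _*_; _∸_; _≤_; _<_; _⊔_; z≤n; s≤s)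
open import Data.Nat.Properties hiding (_≟_; <-cmp)
open import Data.Nat.Tactic.RingSolver using (solve-∀)
open import Data.Nat.ListAction using () renaming (sum to sumᴸ)
open import Data.Fin using (Fin; zero; suc; toℕ; #_)
open import Data.Fin.Properties using (_≟_; all?)
import Data.Fin.Properties as Finₚ
open import Data.Fin.Subset using (Subset; _∈_; ∣_∣; ⁅_⁆; _∪_; _-_)
open import Data.Fin.Subset.Properties
  using (x∈p∪q⁺; x∈p∪q⁻; x∈⁅x⁆; x∈⁅y⁆⇒x≡y; x∈p∧x≢y⇒x∈p-y; x∈p⇒∣p-x∣<∣p∣)
open import Data.Vec using ([]; _∷_; lookup)
open import Data.Vec.Properties using ([]=⇒lookup; lookup⇒[]=)
open import Data.List using (List; []; _∷_; filterᵇ; length; map; tabulate)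
open import Data.List.Membership.Propositional using () renaming (_∈_ to _∈ˡ_)
open import Data.List.Relation.Unary.Any using (here; there)
open import Data.Bool using (Bool; true; false; _∧_; not; if_then_else_)
open import Data.Bool.Properties
  using (∧-assoc; ∧-zeroʳ; ∧-identityʳ; ∨-zeroʳ; ∧-conicalˡ; ∧-conicalʳ; not-injective; T-≡;
         ∧-commutativeMonoid)
open import Algebra.Solver.CommutativeMonoid ∧-commutativeMonoid using (solve; _⊜_) renaming (_⊕_ to _∙_)
open import Algebra.Properties.Semiring.Sum +-*-semiring
  using (∑-distrib-+; ∑-comm; *-distribˡ-sum) renaming (sum to ∑)
open import Data.Maybe using (just; nothing)
open import Data.Maybe.Properties using (just-injective)
open import Data.Product using (∃; Σ; _×_; _,_; proj₁; proj₂)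
open import Data.Sum using (_⊎_; inj₁; inj₂)
open import Data.Empty using (⊥; ⊥-elim)
open import Function using (_∘_; id; Equivalence)
open import Relation.Binary using (tri<; tri≈; tri>)
open import Relation.Binary.PropositionalEquality
open import Relation.Nullary using (yes; no; ¬_)
open import Relation.Nullary.Decidable using (from-yes; ¬?; _⊎-dec_)

-- Counting through indicator sums

𝟙 : Bool → ℕ
𝟙 true  = 1
𝟙 false = 0

𝟙≤1 : ∀ b → 𝟙 b ≤ 1
𝟙≤1 true  = s≤s z≤n
𝟙≤1 false = z≤n

𝟙-∧ : ∀ x y → 𝟙 (x ∧ y) ≡ 𝟙 x * 𝟙 y
𝟙-∧ true  y = sym (+-identityʳ (𝟙 y))
𝟙-∧ false y = refl

𝟙-mono : ∀ {x y} → (x ≡ true → y ≡ true) → 𝟙 x ≤ 𝟙 y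
𝟙-mono {false} _   = z≤n
𝟙-mono {true}  x⇒y rewrite x⇒y refl = ≤-refl

∑-cong : ∀ {n} {f g : Fin n → ℕ} → (∀ i → f i ≡ g i) → ∑ f ≡ ∑ g
∑-cong {zero}  f≗g = refl
∑-cong {suc n} f≗g = cong₂ _+_ (f≗g zero) (∑-cong (f≗g ∘ suc))

∑-mono-≤ : ∀ {n} {f g : Fin n → ℕ} → (∀ i → f i ≤ g i) → ∑ f ≤ ∑ g
∑-mono-≤ {zero}  f≤g = z≤n
∑-mono-≤ {suc n} f≤g = +-mono-≤ (f≤g zero) (∑-mono-≤ (f≤g ∘ suc))

∑-const : ∀ {n} c → ∑ {n} (λ _ → c) ≡ n * c
∑-const {zero}  c = refl
∑-const {suc n} c = cong (c +_) (∑-const {n} c)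

∑-*ʳ : ∀ {n} (f : Fin n → ℕ) c → ∑ (λ i → f i * c) ≡ ∑ f * c
∑-*ʳ {zero}  f c = refl
∑-*ʳ {suc n} f c = trans (cong (f zero * c +_) (∑-*ʳ (f ∘ suc) c))
                         (sym (*-distribʳ-+ c (f zero) (∑ (f ∘ suc))))

suc-==F-suc : ∀ {n} (x y : Fin n) → (suc x ==F suc y) ≡ (x ==F y)
suc-==F-suc x y with x ≟ y
... | yes refl = refl
... | no  x≢y  = refl

==F-refl : ∀ {n} (x : Fin n) → (x ==F x) ≡ true
==F-refl x with x ≟ x
... | yes _   = refl
... | no  x≢x = ⊥-elim (x≢x refl)

==F-≢ : ∀ {n} {x y : Fin n} → x ≢ y → (x ==F y) ≡ false
==F-≢ {x = x} {y} x≢y with x ≟ y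
... | yes x≡y = ⊥-elim (x≢y x≡y)
... | no  _   = refl

==F-≡ : ∀ {n} {x y : Fin n} → (x ==F y) ≡ true → x ≡ y
==F-≡ {x = x} {y} eq with x ≟ y
... | yes x≡y = x≡y

==F-false⇒≢ : ∀ {n} {x y : Fin n} → (x ==F y) ≡ false → x ≢ y
==F-false⇒≢ {x = x} x≠y refl with () ← trans (sym x≠y) (==F-refl x)

∑-point : ∀ {n} (x : Fin n) (f : Fin n → ℕ) → ∑ (λ i → 𝟙 (i ==F x) * f i) ≡ f x
∑-point {suc n} zero f = begin
  f zero + 0 + ∑ {n} (λ _ → 0) ≡⟨ cong (f zero + 0 +_) (trans (∑-const {n} 0) (*-zeroʳ n)) ⟩
  f zero + 0 + 0               ≡⟨ trans (+-identityʳ _) (+-identityʳ _) ⟩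
  f zero                       ∎
  where open ≡-Reasoning
∑-point {suc n} (suc x) f = trans
  (cong (0 +_) (∑-cong λ i → cong (λ b → 𝟙 b * f (suc i)) (suc-==F-suc i x)))
  (∑-point x (f ∘ suc))

private
  length-filter-tabulate : ∀ {n} {A : Set} (p : A → Bool) (g : Fin n → A) →
    length (filterᵇ p (tabulate g)) ≡ ∑ (𝟙 ∘ p ∘ g)
  length-filter-tabulate {zero}  p g = refl
  length-filter-tabulate {suc n} p g with p (g zero)
  ... | true  = cong suc (length-filter-tabulate p (g ∘ suc))
  ... | false = length-filter-tabulate p (g ∘ suc)

  sum-map-tabulate : ∀ {n} {A : Set} (f : A → ℕ) (g : Fin n → A) → sumᴸ (map f (tabulate g)) ≡ ∑ (f ∘ g)
  sum-map-tabulate {zero}  f g = refl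
  sum-map-tabulate {suc n} f g = cong (f (g zero) +_) (sum-map-tabulate f (g ∘ suc))

count≡∑ : ∀ {n} (p : Fin n → Bool) → count p ≡ ∑ (𝟙 ∘ p)
count≡∑ p = length-filter-tabulate p id

sumFin≡∑ : ∀ {n} (f : Fin n → ℕ) → sumFin f ≡ ∑ f
sumFin≡∑ f = sum-map-tabulate f id

private
  ∑-𝟙-witness : ∀ {n} (p : Fin n → Bool) → ∑ (𝟙 ∘ p) ≡ 0 ⊎ ∃ λ x → p x ≡ true
  ∑-𝟙-witness {zero}  p = inj₁ refl
  ∑-𝟙-witness {suc n} p with p zero in p0
  ... | true  = inj₂ (zero , p0)
  ... | false with ∑-𝟙-witness (p ∘ suc)
  ...   | inj₁ none     = inj₁ none
  ...   | inj₂ (x , px) = inj₂ (suc x , px)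

module _ {n : ℕ} where

  count-mono : {p q : Fin n → Bool} → (∀ x → p x ≡ true → q x ≡ true) → count p ≤ count q
  count-mono {p} {q} p⇒q rewrite count≡∑ p | count≡∑ q = ∑-mono-≤ λ x → 𝟙-mono (p⇒q x)

  count-disjoint-∪ : {p q r : Fin n → Bool} → (∀ x → q x ≡ true → p x ≡ true) →
                     (∀ x → r x ≡ true → p x ≡ true) → (∀ x → q x ≡ true → r x ≡ false) →
                     count q + count r ≤ count p
  count-disjoint-∪ {p} {q} {r} q⇒p r⇒p disjoint rewrite count≡∑ p | count≡∑ q | count≡∑ r =
    ≤-trans (≤-reflexive (sym (∑-distrib-+ (𝟙 ∘ q) (𝟙 ∘ r)))) (∑-mono-≤ pointwise)
    where
    pointwise : ∀ x → 𝟙 (q x) + 𝟙 (r x) ≤ 𝟙 (p x)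
    pointwise x with q x in qx | r x in rx
    ... | false | false = z≤n
    ... | false | true  rewrite r⇒p x rx = ≤-refl
    ... | true  | false rewrite q⇒p x qx = ≤-refl
    ... | true  | true  with () ← trans (sym rx) (disjoint x qx)

  count-split : (p q : Fin n → Bool) → count p ≡ count (λ x → p x ∧ q x) + count (λ x → p x ∧ not (q x))
  count-split p q rewrite count≡∑ p | count≡∑ (λ x → p x ∧ q x) | count≡∑ (λ x → p x ∧ not (q x)) =
    trans (∑-cong pointwise) (∑-distrib-+ (λ x → 𝟙 (p x ∧ q x)) (λ x → 𝟙 (p x ∧ not (q x))))
    where
    pointwise : ∀ x → 𝟙 (p x) ≡ 𝟙 (p x ∧ q x) + 𝟙 (p x ∧ not (q x))
    pointwise x with p x | q x
    ... | false | _     = refl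
    ... | true  | true  = refl
    ... | true  | false = refl

  count-point : (y : Fin n) → count (_==F y) ≡ 1
  count-point y = trans (count≡∑ (_==F y))
    (trans (∑-cong λ x → sym (*-identityʳ (𝟙 (x ==F y)))) (∑-point y (λ _ → 1)))

  count-witness : (p : Fin n → Bool) → count p ≡ 0 ⊎ ∃ λ x → p x ≡ true
  count-witness p rewrite count≡∑ p = ∑-𝟙-witness p

  count-subsingleton : {p : Fin n → Bool} → (∀ x y → p x ≡ true → p y ≡ true → x ≡ y) → count p ≤ 1
  count-subsingleton {p} unique with count-witness p
  ... | inj₁ none     = ≤-trans (≤-reflexive none) z≤n
  ... | inj₂ (x , px) = ≤-trans (count-mono into-x) (≤-reflexive (count-point x))
    where
    into-x : ∀ y → p y ≡ true → (y ==F x) ≡ true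
    into-x y py = subst (λ z → (y ==F z) ≡ true) (unique y x py px) (==F-refl y)

  count-others : (p : Fin n → Bool) (y : Fin n) → count p ∸ 1 ≤ count (λ z → p z ∧ not (z ==F y))
  count-others p y = m≤n+o⇒m∸n≤o (count p) 1 (begin
    count p                                                     ≡⟨ count-split p (_==F y) ⟩
    count (λ z → p z ∧ (z ==F y)) + count (λ z → p z ∧ not (z ==F y))
      ≤⟨ +-monoˡ-≤ _ (≤-trans (count-mono λ z → ∧-conicalʳ (p z) (z ==F y)) (≤-reflexive (count-point y))) ⟩
    1 + count (λ z → p z ∧ not (z ==F y))                       ∎)
    where open ≤-Reasoning

𝟙-cover₂ : ∀ {b p q} → (b ≡ true → p ≡ true ⊎ q ≡ true) → 𝟙 b ≤ 𝟙 p + 𝟙 q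
𝟙-cover₂ {false} _ = z≤n
𝟙-cover₂ {true} {p} {q} cover with cover refl
... | inj₁ refl = s≤s z≤n
... | inj₂ refl = m≤n+m 1 (𝟙 p)

𝟙-cover₃ : ∀ {b p q r} → (b ≡ true → p ≡ true ⊎ q ≡ true ⊎ r ≡ true) → 𝟙 b ≤ 𝟙 p + 𝟙 q + 𝟙 r
𝟙-cover₃ {false} _ = z≤n
𝟙-cover₃ {true} {p} {q} {r} cover with cover refl
... | inj₁ refl        = s≤s z≤n
... | inj₂ (inj₁ refl) = ≤-trans (s≤s z≤n) (≤-trans (m≤n+m 1 (𝟙 p)) (m≤m+n _ (𝟙 r)))
... | inj₂ (inj₂ refl) = ≤-trans (s≤s z≤n) (m≤n+m 1 (𝟙 p + 𝟙 q))

𝟙-cover₄ : ∀ {b p q r s} → (b ≡ true → p ≡ true ⊎ q ≡ true ⊎ r ≡ true ⊎ s ≡ true) →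
           𝟙 b ≤ 𝟙 p + 𝟙 q + 𝟙 r + 𝟙 s
𝟙-cover₄ {false} _ = z≤n
𝟙-cover₄ {true} {p} {q} {r} {s} cover with cover refl
... | inj₁ refl               = s≤s z≤n
... | inj₂ (inj₁ refl)        = ≤-trans (m≤n+m 1 (𝟙 p)) (≤-trans (m≤m+n _ (𝟙 r)) (m≤m+n _ (𝟙 s)))
... | inj₂ (inj₂ (inj₁ refl)) = ≤-trans (m≤n+m 1 (𝟙 p + 𝟙 q)) (m≤m+n _ (𝟙 s))
... | inj₂ (inj₂ (inj₂ refl)) = m≤n+m 1 (𝟙 p + 𝟙 q + 𝟙 r)

count-cover₂ : ∀ {n} {p q r : Fin n → Bool} → (∀ x → p x ≡ true → q x ≡ true ⊎ r x ≡ true) →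
  count p ≤ count q + count r
count-cover₂ {p = p} {q} {r} cover rewrite count≡∑ p | count≡∑ q | count≡∑ r =
  ≤-trans (∑-mono-≤ λ x → 𝟙-cover₂ (cover x)) (≤-reflexive (∑-distrib-+ (𝟙 ∘ q) (𝟙 ∘ r)))

count-cover₄ : ∀ {n} {p q₁ q₂ q₃ q₄ : Fin n → Bool} →
  (∀ x → p x ≡ true → q₁ x ≡ true ⊎ q₂ x ≡ true ⊎ q₃ x ≡ true ⊎ q₄ x ≡ true) →
  count p ≤ count q₁ + count q₂ + count q₃ + count q₄
count-cover₄ {p = p} {q₁} {q₂} {q₃} {q₄} cover
  rewrite count≡∑ p | count≡∑ q₁ | count≡∑ q₂ | count≡∑ q₃ | count≡∑ q₄ =
  ≤-trans (∑-mono-≤ λ x → 𝟙-cover₄ (cover x)) (≤-reflexive (begin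
    ∑ (λ x → 𝟙 (q₁ x) + 𝟙 (q₂ x) + 𝟙 (q₃ x) + 𝟙 (q₄ x))
      ≡⟨ ∑-distrib-+ (λ x → 𝟙 (q₁ x) + 𝟙 (q₂ x) + 𝟙 (q₃ x)) (𝟙 ∘ q₄) ⟩
    ∑ (λ x → 𝟙 (q₁ x) + 𝟙 (q₂ x) + 𝟙 (q₃ x)) + ∑ (𝟙 ∘ q₄)
      ≡⟨ cong (_+ ∑ (𝟙 ∘ q₄)) (∑-distrib-+ (λ x → 𝟙 (q₁ x) + 𝟙 (q₂ x)) (𝟙 ∘ q₃)) ⟩
    ∑ (λ x → 𝟙 (q₁ x) + 𝟙 (q₂ x)) + ∑ (𝟙 ∘ q₃) + ∑ (𝟙 ∘ q₄)
      ≡⟨ cong (λ a → a + ∑ (𝟙 ∘ q₃) + ∑ (𝟙 ∘ q₄)) (∑-distrib-+ (𝟙 ∘ q₁) (𝟙 ∘ q₂)) ⟩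
    ∑ (𝟙 ∘ q₁) + ∑ (𝟙 ∘ q₂) + ∑ (𝟙 ∘ q₃) + ∑ (𝟙 ∘ q₄) ∎))
  where open ≡-Reasoning

-- Sums over sorted tuples

Fun³ Fun⁴ : ℕ → Set
Fun³ n = Fin n → Fin n → Fin n → ℕ
Fun⁴ n = Fin n → Fin n → Fin n → Fin n → ℕ

module _ {n : ℕ} where

  <F-true : ∀ (x y : Fin n) → toℕ x < toℕ y → (x <F y) ≡ true
  <F-true x y x<y = Equivalence.to T-≡ (<⇒<ᵇ x<y)

  <F-false : ∀ (x y : Fin n) → toℕ y < toℕ x → (x <F y) ≡ false
  <F-false x y y<x with x <F y in x<y
  ... | false = refl
  ... | true  = ⊥-elim (<-asym y<x (<ᵇ⇒< (toℕ x) (toℕ y) (Equivalence.from T-≡ x<y)))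

  <F⇒< : ∀ (x y : Fin n) → (x <F y) ≡ true → toℕ x < toℕ y
  <F⇒< x y eq = <ᵇ⇒< (toℕ x) (toℕ y) (Equivalence.from T-≡ eq)

  <F-trans : ∀ (x y z : Fin n) → (x <F y) ≡ true → (y <F z) ≡ true → (x <F z) ≡ true
  <F-trans x y z x<y y<z = <F-true x z (<-trans (<F⇒< x y x<y) (<F⇒< y z y<z))

  sorted₃ : Fin n → Fin n → Fin n → Bool
  sorted₃ x y z = (x <F y) ∧ (y <F z)

  sorted₄ : Fin n → Fin n → Fin n → Fin n → Bool
  sorted₄ a b c d = (a <F b) ∧ (b <F c) ∧ (c <F d)

  private
    𝟙-∧-false : ∀ a → 𝟙 (a ∧ false) ≡ 0
    𝟙-∧-false a = cong 𝟙 (∧-zeroʳ a)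

    chain-false : ∀ (x y z : Fin n) → (x <F z) ≡ false → ∀ w → ((x <F y) ∧ (y <F z) ∧ w) ≡ false
    chain-false x y z x≮z w with x <F y in x<y | y <F z in y<z
    ... | false | _     = refl
    ... | true  | false = refl
    ... | true  | true  with () ← trans (sym x≮z) (<F-trans x y z x<y y<z)

    sorted₃-false : ∀ (x y z : Fin n) → (x <F z) ≡ false → sorted₃ x y z ≡ false
    sorted₃-false x y z x≮z =
      trans (cong ((x <F y) ∧_) (sym (∧-identityʳ (y <F z)))) (chain-false x y z x≮z true)

  -- A vertex outside a sorted triple lies in exactly one of its four gaps.
  insertion-weights : {u x y z : Fin n} → u ≢ x → u ≢ y → u ≢ z →
    𝟙 (sorted₄ u x y z) + 𝟙 (sorted₄ x u y z) + 𝟙 (sorted₄ x y u z) + 𝟙 (sorted₄ x y z u) ≡ 𝟙 (sorted₃ x y z)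
  insertion-weights {u} {x} {y} {z} u≢x u≢y u≢z with x <F y in x<y | y <F z in y<z
  ... | false | w = cong₂ (λ a b → 𝟙 a + 𝟙 b + 0 + 0) (∧-zeroʳ (u <F x)) (chain-false x u y x<y w)
  ... | true  | false rewrite 𝟙-∧-false (u <F x) | ∧-zeroʳ (u <F y) | 𝟙-∧-false (x <F u)
                            | sorted₃-false y u z y<z = refl
  ... | true  | true with Finₚ.<-cmp u x
  ...   | tri≈ _ u≡x _ = ⊥-elim (u≢x u≡x)
  ...   | tri< u<x _ _ rewrite <F-true u x u<x | <F-false x u u<x
                             | <F-false y u (Finₚ.<-trans u<x (<F⇒< x y x<y))
                             | <F-false z u (Finₚ.<-trans (Finₚ.<-trans u<x (<F⇒< x y x<y)) (<F⇒< y z y<z)) = refl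
  ...   | tri> _ _ x<u with Finₚ.<-cmp u y
  ...     | tri≈ _ u≡y _ = ⊥-elim (u≢y u≡y)
  ...     | tri< u<y _ _ rewrite <F-false u x x<u | <F-true x u x<u | <F-true u y u<y
                               | <F-false y u u<y | <F-false z u (Finₚ.<-trans u<y (<F⇒< y z y<z)) = refl
  ...     | tri> _ _ y<u with Finₚ.<-cmp u z
  ...       | tri≈ _ u≡z _ = ⊥-elim (u≢z u≡z)
  ...       | tri< u<z _ _ rewrite <F-false u x x<u | <F-true x u x<u | <F-false u y y<u
                                 | <F-true y u y<u | <F-true u z u<z | <F-false z u u<z = refl
  ...       | tri> _ _ z<u rewrite <F-false u x x<u | <F-true x u x<u | <F-false u y y<u
                                 | <F-true y u y<u | <F-false u z z<u | <F-true z u z<u = refl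

  ∑³ : Fun³ n → ℕ
  ∑³ g = ∑ λ x → ∑ λ y → ∑ λ z → g x y z

  ∑⁴ : Fun⁴ n → ℕ
  ∑⁴ F = ∑ λ a → ∑³ (F a)

  ∑³-cong : {g h : Fun³ n} → (∀ x y z → g x y z ≡ h x y z) → ∑³ g ≡ ∑³ h
  ∑³-cong g≗h = ∑-cong λ x → ∑-cong λ y → ∑-cong λ z → g≗h x y z

  ∑⁴-cong : {F G : Fun⁴ n} → (∀ a b c d → F a b c d ≡ G a b c d) → ∑⁴ F ≡ ∑⁴ G
  ∑⁴-cong F≗G = ∑-cong λ a → ∑³-cong (F≗G a)

  ∑³-mono-≤ : {g h : Fun³ n} → (∀ x y z → g x y z ≤ h x y z) → ∑³ g ≤ ∑³ h
  ∑³-mono-≤ g≤h = ∑-mono-≤ λ x → ∑-mono-≤ λ y → ∑-mono-≤ λ z → g≤h x y z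

  ∑³-distrib-+ : (g h : Fun³ n) → ∑³ (λ x y z → g x y z + h x y z) ≡ ∑³ g + ∑³ h
  ∑³-distrib-+ g h = trans
    (∑-cong λ x → trans (∑-cong λ y → ∑-distrib-+ (g x y) (h x y))
                        (∑-distrib-+ (λ y → ∑ (g x y)) (λ y → ∑ (h x y))))
    (∑-distrib-+ (λ x → ∑ λ y → ∑ (g x y)) (λ x → ∑ λ y → ∑ (h x y)))

  ∑⁴-distrib-+ : (F G : Fun⁴ n) → ∑⁴ (λ a b c d → F a b c d + G a b c d) ≡ ∑⁴ F + ∑⁴ G
  ∑⁴-distrib-+ F G = trans (∑-cong λ a → ∑³-distrib-+ (F a) (G a)) (∑-distrib-+ (∑³ ∘ F) (∑³ ∘ G))

  ∑³-swap₀₁ : (g : Fun³ n) → ∑³ (λ x y z → g y x z) ≡ ∑³ g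
  ∑³-swap₀₁ g = ∑-comm λ x y → ∑ (g y x)

  ∑³-swap₁₂ : (g : Fun³ n) → ∑³ (λ x y z → g x z y) ≡ ∑³ g
  ∑³-swap₁₂ g = ∑-cong λ x → ∑-comm λ y z → g x z y

  ∑⁴-swap₀₁ : (F : Fun⁴ n) → ∑⁴ (λ a b c d → F b a c d) ≡ ∑⁴ F
  ∑⁴-swap₀₁ F = ∑-comm λ a b → ∑ λ c → ∑ λ d → F b a c d

  ∑⁴-swap₁₂ : (F : Fun⁴ n) → ∑⁴ (λ a b c d → F a c b d) ≡ ∑⁴ F
  ∑⁴-swap₁₂ F = ∑-cong λ a → ∑³-swap₀₁ (F a)

  ∑⁴-swap₂₃ : (F : Fun⁴ n) → ∑⁴ (λ a b c d → F a b d c) ≡ ∑⁴ F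
  ∑⁴-swap₂₃ F = ∑-cong λ a → ∑³-swap₁₂ (F a)

  ∑³-rotate : (G : Fun³ n) → ∑³ (λ x y z → G y z x) ≡ ∑³ G
  ∑³-rotate G = trans (∑³-swap₀₁ λ x y z → G x z y) (∑³-swap₁₂ G)

  ∑³-rotate⁻¹ : (G : Fun³ n) → ∑³ (λ x y z → G z x y) ≡ ∑³ G
  ∑³-rotate⁻¹ G = trans (∑³-swap₁₂ λ x y z → G y x z) (∑³-swap₀₁ G)

  ∑³-reverse : (G : Fun³ n) → ∑³ (λ x y z → G z y x) ≡ ∑³ G
  ∑³-reverse G = trans (∑³-rotate λ x y z → G y x z) (∑³-swap₀₁ G)

  ∑³-first : (h : Fin n → ℕ) → ∑³ (λ x y z → h x) ≡ ∑ h * (n * n)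
  ∑³-first h = begin
    ∑³ (λ x y z → h x)            ≡⟨ ∑-cong (λ x → ∑-cong {n} λ _ → ∑-const {n} (h x)) ⟩
    ∑ (λ x → ∑ {n} (λ _ → n * h x)) ≡⟨ ∑-cong (λ x → ∑-const {n} (n * h x)) ⟩
    ∑ (λ x → n * (n * h x))         ≡⟨ ∑-cong (λ x → trans (sym (*-assoc n n (h x))) (*-comm (n * n) (h x))) ⟩
    ∑ (λ x → h x * (n * n))         ≡⟨ ∑-*ʳ h (n * n) ⟩
    ∑ h * (n * n)                   ∎
    where open ≡-Reasoning

  ∑<³ : Fun³ n → ℕ
  ∑<³ g = ∑³ λ x y z → 𝟙 (sorted₃ x y z) * g x y z

  ∑<⁴ : Fun⁴ n → ℕ
  ∑<⁴ F = ∑⁴ λ a b c d → 𝟙 (sorted₄ a b c d) * F a b c d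

  ∑<³-cong : {g h : Fun³ n} → (∀ x y z → g x y z ≡ h x y z) → ∑<³ g ≡ ∑<³ h
  ∑<³-cong g≗h = ∑³-cong λ x y z → cong (𝟙 (sorted₃ x y z) *_) (g≗h x y z)

  ∑<³-distrib-+ : (g h : Fun³ n) → ∑<³ (λ x y z → g x y z + h x y z) ≡ ∑<³ g + ∑<³ h
  ∑<³-distrib-+ g h = trans (∑³-cong λ x y z → *-distribˡ-+ (𝟙 (sorted₃ x y z)) (g x y z) (h x y z))
    (∑³-distrib-+ (λ x y z → 𝟙 (sorted₃ x y z) * g x y z) (λ x y z → 𝟙 (sorted₃ x y z) * h x y z))

  ∑<³≤∑³ : (g : Fun³ n) → ∑<³ g ≤ ∑³ g
  ∑<³≤∑³ g = ∑³-mono-≤ λ x y z →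
    ≤-trans (*-monoˡ-≤ (g x y z) (𝟙≤1 (sorted₃ x y z))) (≤-reflexive (*-identityˡ (g x y z)))

  count-triples : (P Q : Fin n → Bool) (T : Fin n → Fin n → Fin n → Bool) →
    (∀ x y z → P x ≡ true → Q y ≡ true → Q z ≡ true → y ≢ z → T x y z ≡ true) →
    count P * (count Q * (count Q ∸ 1)) ≤ ∑³ (λ x y z → 𝟙 (T x y z))
  count-triples P Q T PQQ⇒T = begin
    count P * (count Q * (count Q ∸ 1))
      ≡⟨ cong₂ (λ a b → a * (b * (count Q ∸ 1))) (count≡∑ P) (count≡∑ Q) ⟩
    ∑ (𝟙 ∘ P) * (∑ (𝟙 ∘ Q) * (count Q ∸ 1))
      ≡⟨ trans (∑-cong λ x → cong (𝟙 (P x) *_) (∑-*ʳ (𝟙 ∘ Q) (count Q ∸ 1)))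
               (∑-*ʳ (𝟙 ∘ P) (∑ (𝟙 ∘ Q) * (count Q ∸ 1))) ⟨
    ∑ (λ x → 𝟙 (P x) * ∑ (λ y → 𝟙 (Q y) * (count Q ∸ 1)))
      ≤⟨ ∑-mono-≤ (λ x → *-monoʳ-≤ (𝟙 (P x)) (∑-mono-≤ λ y → *-monoʳ-≤ (𝟙 (Q y)) (count-others Q y))) ⟩
    ∑ (λ x → 𝟙 (P x) * ∑ (λ y → 𝟙 (Q y) * count (λ z → Q z ∧ not (z ==F y))))
      ≡⟨ ∑-cong (λ x → cong (𝟙 (P x) *_) (∑-cong λ y → cong (𝟙 (Q y) *_) (count≡∑ (R y)))) ⟩
    ∑ (λ x → 𝟙 (P x) * ∑ (λ y → 𝟙 (Q y) * ∑ (λ z → 𝟙 (Q z ∧ not (z ==F y)))))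
      ≡⟨ ∑-cong (λ x → trans (*-distribˡ-sum (𝟙 (P x)) (λ y → 𝟙 (Q y) * ∑ (𝟙 ∘ R y))) (∑-cong λ y →
           trans (cong (𝟙 (P x) *_) (*-distribˡ-sum (𝟙 (Q y)) (𝟙 ∘ R y)))
                 (*-distribˡ-sum (𝟙 (P x)) (λ z → 𝟙 (Q y) * 𝟙 (R y z))))) ⟩
    ∑³ (λ x y z → 𝟙 (P x) * (𝟙 (Q y) * 𝟙 (Q z ∧ not (z ==F y))))
      ≤⟨ ∑³-mono-≤ pointwise ⟩
    ∑³ (λ x y z → 𝟙 (T x y z)) ∎
    where
    open ≤-Reasoning
    R : Fin n → Fin n → Bool
    R y z = Q z ∧ not (z ==F y)
    pointwise : ∀ x y z → 𝟙 (P x) * (𝟙 (Q y) * 𝟙 (Q z ∧ not (z ==F y))) ≤ 𝟙 (T x y z)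
    pointwise x y z with P x in px | Q y in qy | Q z in qz | z ==F y in z=y
    ... | false | _     | _     | _     = z≤n
    ... | true  | false | _     | _     = z≤n
    ... | true  | true  | false | _     = z≤n
    ... | true  | true  | true  | true  = ≤-trans (≤-reflexive (*-zeroʳ 1)) z≤n
    ... | true  | true  | true  | false rewrite PQQ⇒T x y z px qy qz (==F-false⇒≢ z=y ∘ sym) = ≤-refl

  record Symmetric⁴ (F : Fun⁴ n) : Set where
    field
      swap₀₁   : ∀ a b c d → F b a c d ≡ F a b c d
      swap₁₂   : ∀ a b c d → F a c b d ≡ F a b c d
      swap₂₃   : ∀ a b c d → F a b d c ≡ F a b c d
      diagonal : ∀ a c d → F a a c d ≡ 0

  ∑³-*ˡ : (k : ℕ) (g : Fun³ n) → ∑³ (λ x y z → k * g x y z) ≡ k * ∑³ g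
  ∑³-*ˡ k g = sym (trans (*-distribˡ-sum k (λ x → ∑ λ y → ∑ (g x y))) (∑-cong λ x →
              trans (*-distribˡ-sum k (λ y → ∑ (g x y))) (∑-cong λ y → *-distribˡ-sum k (g x y))))

  module _ (u : Fin n) where

    ∑⁴-point₀ : (F : Fun⁴ n) →
                ∑⁴ (λ a b c d → 𝟙 (a ==F u) * F a b c d) ≡ ∑³ (F u)
    ∑⁴-point₀ F = trans (∑-cong λ a → ∑³-*ˡ (𝟙 (a ==F u)) (F a)) (∑-point u (∑³ ∘ F))

    ∑⁴-point₁ : (F : Fun⁴ n) →
                ∑⁴ (λ a b c d → 𝟙 (b ==F u) * F a b c d) ≡ ∑³ (λ x y z → F x u y z)
    ∑⁴-point₁ F = trans (∑⁴-swap₀₁ λ a b c d → 𝟙 (a ==F u) * F b a c d)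
                        (∑⁴-point₀ λ a b c d → F b a c d)

    ∑⁴-point₂ : (F : Fun⁴ n) →
                ∑⁴ (λ a b c d → 𝟙 (c ==F u) * F a b c d) ≡ ∑³ (λ x y z → F x y u z)
    ∑⁴-point₂ F = trans (∑⁴-swap₁₂ λ a b c d → 𝟙 (b ==F u) * F a c b d)
                        (∑⁴-point₁ λ a b c d → F a c b d)

    ∑⁴-point₃ : (F : Fun⁴ n) →
                ∑⁴ (λ a b c d → 𝟙 (d ==F u) * F a b c d) ≡ ∑³ (λ x y z → F x y z u)
    ∑⁴-point₃ F = trans (∑⁴-swap₂₃ λ a b c d → 𝟙 (c ==F u) * F a b d c)
                        (∑⁴-point₂ λ a b c d → F a b d c)

    private
      𝟙-split : ∀ b m → m ≡ 𝟙 b * m + 𝟙 (not b) * m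
      𝟙-split true  m = sym (trans (+-identityʳ _) (+-identityʳ m))
      𝟙-split false m = sym (+-identityʳ m)

      off : Fin n → ℕ → ℕ
      off x m = 𝟙 (not (x ==F u)) * m

      off-cong : ∀ x {m m′} → (x ≢ u → m ≡ m′) → off x m ≡ off x m′
      off-cong x m≡m′ with x ≟ u
      ... | yes _   = refl
      ... | no  x≢u = cong (1 *_) (m≡m′ x≢u)

      off-≢ : ∀ {x} m → x ≢ u → off x m ≡ m
      off-≢ {x} m x≢u rewrite ==F-≢ x≢u = *-identityˡ m

      sortedPart : Fun⁴ n → Fun⁴ n
      sortedPart F a b c d = 𝟙 (sorted₄ a b c d) * F a b c d

    avoidingPart : Fun⁴ n → Fun⁴ n
    avoidingPart F a b c d = off d (off c (off b (off a (sortedPart F a b c d))))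

    avoidingPart-cong : {F G : Fun⁴ n} →
      (∀ a b c d → a ≢ u → b ≢ u → c ≢ u → d ≢ u → F a b c d ≡ G a b c d) →
      ∑⁴ (avoidingPart F) ≡ ∑⁴ (avoidingPart G)
    avoidingPart-cong F≗G = ∑⁴-cong λ a b c d →
      off-cong d λ d≢u → off-cong c λ c≢u → off-cong b λ b≢u → off-cong a λ a≢u →
      cong (𝟙 (sorted₄ a b c d) *_) (F≗G a b c d a≢u b≢u c≢u d≢u)

    private
      split : (p : Fin n → Fin n → Fin n → Fin n → Bool) (G : Fun⁴ n) →
              ∑⁴ G ≡ ∑⁴ (λ a b c d → 𝟙 (p a b c d) * G a b c d)
                   + ∑⁴ (λ a b c d → 𝟙 (not (p a b c d)) * G a b c d)
      split p G = trans (∑⁴-cong λ a b c d → 𝟙-split (p a b c d) (G a b c d))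
        (∑⁴-distrib-+ (λ a b c d → 𝟙 (p a b c d) * G a b c d) (λ a b c d → 𝟙 (not (p a b c d)) * G a b c d))

      peel₀ : (G : Fun⁴ n) →
              ∑⁴ G ≡ ∑³ (G u) + ∑⁴ (λ a b c d → off a (G a b c d))
      peel₀ G = trans (split (λ a b c d → a ==F u) G)
                      (cong (_+ ∑⁴ (λ a b c d → off a (G a b c d))) (∑⁴-point₀ G))

      peel₁ : (G : Fun⁴ n) →
              ∑⁴ G ≡ ∑³ (λ x y z → G x u y z) + ∑⁴ (λ a b c d → off b (G a b c d))
      peel₁ G = trans (split (λ a b c d → b ==F u) G)
                      (cong (_+ ∑⁴ (λ a b c d → off b (G a b c d))) (∑⁴-point₁ G))

      peel₂ : (G : Fun⁴ n) →
              ∑⁴ G ≡ ∑³ (λ x y z → G x y u z) + ∑⁴ (λ a b c d → off c (G a b c d))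
      peel₂ G = trans (split (λ a b c d → c ==F u) G)
                      (cong (_+ ∑⁴ (λ a b c d → off c (G a b c d))) (∑⁴-point₂ G))

      peel₃ : (G : Fun⁴ n) →
              ∑⁴ G ≡ ∑³ (λ x y z → G x y z u) + ∑⁴ (λ a b c d → off d (G a b c d))
      peel₃ G = trans (split (λ a b c d → d ==F u) G)
                      (cong (_+ ∑⁴ (λ a b c d → off d (G a b c d))) (∑⁴-point₃ G))

      ≡-or-≢ : ∀ x → x ≡ u ⊎ x ≢ u
      ≡-or-≢ x with x ≟ u
      ... | yes x≡u = inj₁ x≡u
      ... | no  x≢u = inj₂ x≢u

      both-zero : ∀ a b {v} → v ≡ 0 → a * v ≡ b * v
      both-zero a b refl = trans (*-zeroʳ a) (sym (*-zeroʳ b))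

      factor : ∀ p₀ p₁ p₂ p₃ q₁ q₂ q₃ v →
        p₀ * v + q₁ * (p₁ * v) + q₂ * (q₁ * (p₂ * v)) + q₃ * (q₂ * (q₁ * (p₃ * v)))
          ≡ (p₀ + q₁ * p₁ + q₂ * (q₁ * p₂) + q₃ * (q₂ * (q₁ * p₃))) * v
      factor = solve-∀

    module _ {F : Fun⁴ n} (symmetric : Symmetric⁴ F) where
      open Symmetric⁴ symmetric

      private
        at₁ : ∀ x y z → F x u y z ≡ F u x y z
        at₁ x y z = swap₀₁ u x y z

        at₂ : ∀ x y z → F x y u z ≡ F u x y z
        at₂ x y z = trans (swap₁₂ x u y z) (at₁ x y z)

        at₃ : ∀ x y z → F x y z u ≡ F u x y z
        at₃ x y z = trans (swap₂₃ x y u z) (at₂ x y z)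

        weight : Fun³ n
        weight x y z = 𝟙 (sorted₄ u x y z) + off x (𝟙 (sorted₄ x u y z))
                     + off y (off x (𝟙 (sorted₄ x y u z))) + off z (off y (off x (𝟙 (sorted₄ x y z u))))

        weighted : ∀ x y z → weight x y z * F u x y z ≡ 𝟙 (sorted₃ x y z) * F u x y z
        weighted x y z with ≡-or-≢ x | ≡-or-≢ y | ≡-or-≢ z
        ... | inj₁ x≡u | _ | _ = both-zero (weight x y z) (𝟙 (sorted₃ x y z))
          (trans (cong (λ w → F u w y z) x≡u) (diagonal u y z))
        ... | inj₂ _ | inj₁ y≡u | _ = both-zero (weight x y z) (𝟙 (sorted₃ x y z))
          (trans (cong (λ w → F u x w z) y≡u) (trans (swap₁₂ u u x z) (diagonal u x z)))
        ... | inj₂ _ | inj₂ _ | inj₁ z≡u = both-zero (weight x y z) (𝟙 (sorted₃ x y z))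
          (trans (cong (F u x y) z≡u) (trans (swap₂₃ u x u y) (trans (swap₁₂ u u x y) (diagonal u x y))))
        ... | inj₂ x≢u | inj₂ y≢u | inj₂ z≢u
          rewrite off-≢ (𝟙 (sorted₄ x u y z)) x≢u
                | off-≢ (𝟙 (sorted₄ x y u z)) x≢u | off-≢ (𝟙 (sorted₄ x y u z)) y≢u
                | off-≢ (𝟙 (sorted₄ x y z u)) x≢u | off-≢ (𝟙 (sorted₄ x y z u)) y≢u
                | off-≢ (𝟙 (sorted₄ x y z u)) z≢u =
          cong (_* F u x y z) (insertion-weights (x≢u ∘ sym) (y≢u ∘ sym) (z≢u ∘ sym))

        merge : ∀ x y z → sortedPart F u x y z + off x (sortedPart F x u y z)
                        + off y (off x (sortedPart F x y u z)) + off z (off y (off x (sortedPart F x y z u)))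
                        ≡ 𝟙 (sorted₃ x y z) * F u x y z
        merge x y z rewrite at₁ x y z | at₂ x y z | at₃ x y z =
          trans (factor (𝟙 (sorted₄ u x y z)) (𝟙 (sorted₄ x u y z)) (𝟙 (sorted₄ x y u z)) (𝟙 (sorted₄ x y z u))
                        (𝟙 (not (x ==F u))) (𝟙 (not (y ==F u))) (𝟙 (not (z ==F u))) (F u x y z))
                (weighted x y z)

      -- Peeling off the sorted 4-tuples with u in each position in turn leaves those avoiding u;
      -- by insertion-weights, what is peeled off counts each sorted triple completed by u once.
      link-decomposition : ∑<⁴ F ≡ ∑⁴ (avoidingPart F) + ∑<³ (F u)
      link-decomposition = begin
        ∑⁴ K₀                          ≡⟨ peel₀ K₀ ⟩
        T₀ + ∑⁴ K₁                     ≡⟨ cong (T₀ +_) (peel₁ K₁) ⟩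
        T₀ + (T₁ + ∑⁴ K₂)              ≡⟨ cong (λ m → T₀ + (T₁ + m)) (peel₂ K₂) ⟩
        T₀ + (T₁ + (T₂ + ∑⁴ K₃))       ≡⟨ cong (λ m → T₀ + (T₁ + (T₂ + m))) (peel₃ K₃) ⟩
        T₀ + (T₁ + (T₂ + (T₃ + R)))    ≡⟨ shuffle T₀ T₁ T₂ T₃ R ⟩
        R + (T₀ + T₁ + T₂ + T₃)        ≡⟨ cong (R +_) merged ⟩
        R + ∑<³ (F u)                  ∎
        where
        open ≡-Reasoning
        K₀ K₁ K₂ K₃ : Fun⁴ n
        K₀ = sortedPart F
        K₁ a b c d = off a (K₀ a b c d)
        K₂ a b c d = off b (K₁ a b c d)
        K₃ a b c d = off c (K₂ a b c d)
        T₀ T₁ T₂ T₃ R : ℕ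
        T₀ = ∑³ (K₀ u)
        T₁ = ∑³ λ x y z → K₁ x u y z
        T₂ = ∑³ λ x y z → K₂ x y u z
        T₃ = ∑³ λ x y z → K₃ x y z u
        R = ∑⁴ (avoidingPart F)
        shuffle : ∀ a b c d e → a + (b + (c + (d + e))) ≡ e + (a + b + c + d)
        shuffle = solve-∀
        merged : T₀ + T₁ + T₂ + T₃ ≡ ∑<³ (F u)
        merged = begin
          T₀ + T₁ + T₂ + T₃
            ≡⟨ cong (_+ T₃) (cong (_+ T₂) (∑³-distrib-+ (K₀ u) (λ x y z → K₁ x u y z))) ⟨
          ∑³ (λ x y z → K₀ u x y z + K₁ x u y z) + T₂ + T₃
            ≡⟨ cong (_+ T₃) (∑³-distrib-+ (λ x y z → K₀ u x y z + K₁ x u y z) (λ x y z → K₂ x y u z)) ⟨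
          ∑³ (λ x y z → K₀ u x y z + K₁ x u y z + K₂ x y u z) + T₃
            ≡⟨ ∑³-distrib-+ (λ x y z → K₀ u x y z + K₁ x u y z + K₂ x y u z) (λ x y z → K₃ x y z u) ⟨
          ∑³ (λ x y z → K₀ u x y z + K₁ x u y z + K₂ x y u z + K₃ x y z u)
            ≡⟨ ∑³-cong merge ⟩
          ∑<³ (F u) ∎

  record Symmetric³ (g : Fun³ n) : Set where
    field
      swap₀₁   : ∀ x y z → g y x z ≡ g x y z
      swap₁₂   : ∀ x y z → g x z y ≡ g x y z
      diagonal : ∀ x z → g x x z ≡ 0

  private
    ord : Fun³ n
    ord x y z = 𝟙 (sorted₃ x y z)

    sortings : Fun³ n
    sortings x y z = ord x y z + (ord y x z + (ord x z y + (ord y z x + (ord z x y + ord z y x))))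

    ord-positive : ∀ {x y z : Fin n} → toℕ x < toℕ y → toℕ y < toℕ z → 1 ≤ ord x y z
    ord-positive {x} {y} {z} x<y y<z rewrite <F-true x y x<y | <F-true y z y<z = ≤-refl

    first : ∀ {a} r → 1 ≤ a → 1 ≤ a + r
    first r 1≤a = ≤-trans 1≤a (m≤m+n _ r)

    later : ∀ a {r} → 1 ≤ r → 1 ≤ a + r
    later a 1≤r = ≤-trans 1≤r (m≤n+m _ a)

    sortings-positive : ∀ {x y z} → x ≢ y → y ≢ z → x ≢ z → 1 ≤ sortings x y z
    sortings-positive {x} {y} {z} x≢y y≢z x≢z with Finₚ.<-cmp x y | Finₚ.<-cmp y z
    ... | tri≈ _ x≡y _ | _ = ⊥-elim (x≢y x≡y)
    ... | _ | tri≈ _ y≡z _ = ⊥-elim (y≢z y≡z)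
    ... | tri< x<y _ _ | tri< y<z _ _ = first _ (ord-positive x<y y<z)
    ... | tri> _ _ y<x | tri> _ _ z<y =
      later (ord x y z) (later (ord y x z) (later (ord x z y) (later (ord y z x) (later (ord z x y)
        (ord-positive z<y y<x)))))
    ... | tri< x<y _ _ | tri> _ _ z<y with Finₚ.<-cmp x z
    ...   | tri≈ _ x≡z _ = ⊥-elim (x≢z x≡z)
    ...   | tri< x<z _ _ = later (ord x y z) (later (ord y x z) (first _ (ord-positive x<z z<y)))
    ...   | tri> _ _ z<x =
      later (ord x y z) (later (ord y x z) (later (ord x z y) (later (ord y z x) (first _ (ord-positive z<x x<y)))))
    sortings-positive {x} {y} {z} x≢y y≢z x≢z | tri> _ _ y<x | tri< y<z _ _ with Finₚ.<-cmp x z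
    ...   | tri≈ _ x≡z _ = ⊥-elim (x≢z x≡z)
    ...   | tri< x<z _ _ = later (ord x y z) (first _ (ord-positive y<x x<z))
    ...   | tri> _ _ z<x = later (ord x y z) (later (ord y x z) (later (ord x z y) (first _ (ord-positive y<z z<x))))

  module _ {g : Fun³ n} (symmetric : Symmetric³ g) where
    open Symmetric³ symmetric

    private
      rotate : ∀ x y z → g y z x ≡ g x y z
      rotate x y z = trans (swap₁₂ y x z) (swap₀₁ x y z)

      rotate⁻¹ : ∀ x y z → g z x y ≡ g x y z
      rotate⁻¹ x y z = trans (swap₀₁ x z y) (swap₁₂ x y z)

      reverse : ∀ x y z → g z y x ≡ g x y z
      reverse x y z = trans (swap₀₁ y z x) (rotate x y z)

      term : Fun³ n
      term x y z = ord x y z * g x y z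

      covered : ∀ x y z → g x y z ≤ sortings x y z * g x y z
      covered x y z with x ≟ y | y ≟ z | x ≟ z
      ... | yes x≡y | _ | _ = ≤-trans (≤-reflexive (trans (cong (λ w → g w y z) x≡y) (diagonal y z))) z≤n
      ... | _ | yes y≡z | _ = ≤-trans (≤-reflexive (trans (cong (g x y) (sym y≡z))
                                  (trans (sym (swap₀₁ x y y)) (trans (swap₁₂ y y x) (diagonal y x))))) z≤n
      ... | _ | _ | yes x≡z = ≤-trans (≤-reflexive (trans (cong (g x y) (sym x≡z))
                                  (trans (swap₁₂ x x y) (diagonal x y)))) z≤n
      ... | no x≢y | no y≢z | no x≢z =
        ≤-trans (≤-reflexive (sym (*-identityˡ (g x y z)))) (*-monoˡ-≤ (g x y z) (sortings-positive x≢y y≢z x≢z))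

      expand : ∀ x y z → sortings x y z * g x y z
             ≡ term x y z + (term y x z + (term x z y + (term y z x + (term z x y + term z y x))))
      expand x y z = trans
        (distrib (ord x y z) (ord y x z) (ord x z y) (ord y z x) (ord z x y) (ord z y x) (g x y z))
        (cong (term x y z +_) (cong₂ _+_ (at (ord y x z) (swap₀₁ x y z))
        (cong₂ _+_ (at (ord x z y) (swap₁₂ x y z)) (cong₂ _+_ (at (ord y z x) (rotate x y z))
        (cong₂ _+_ (at (ord z x y) (rotate⁻¹ x y z)) (at (ord z y x) (reverse x y z)))))))
        where
        at : ∀ a {v w} → w ≡ v → a * v ≡ a * w
        at a w≡v = cong (a *_) (sym w≡v)
        distrib : ∀ a b c d e f v → (a + (b + (c + (d + (e + f))))) * v
                ≡ a * v + (b * v + (c * v + (d * v + (e * v + f * v))))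
        distrib = solve-∀

    ∑³≤6*∑<³ : ∑³ g ≤ 6 * ∑<³ g
    ∑³≤6*∑<³ = begin
      ∑³ g                                         ≤⟨ ∑³-mono-≤ covered ⟩
      ∑³ (λ x y z → sortings x y z * g x y z)      ≡⟨ ∑³-cong expand ⟩
      ∑³ (λ x y z → term x y z + (term y x z + (term x z y + (term y z x + (term z x y + term z y x)))))
        ≡⟨ split-sum ⟩
      ∑³ term + (∑³ (λ x y z → term y x z) + (∑³ (λ x y z → term x z y) + (∑³ (λ x y z → term y z x)
           + (∑³ (λ x y z → term z x y) + ∑³ (λ x y z → term z y x)))))
        ≡⟨ cong (∑³ term +_) (cong₂ _+_ (∑³-swap₀₁ term) (cong₂ _+_ (∑³-swap₁₂ term) (cong₂ _+_ (∑³-rotate term)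
             (cong₂ _+_ (∑³-rotate⁻¹ term) (∑³-reverse term))))) ⟩
      ∑³ term + (∑³ term + (∑³ term + (∑³ term + (∑³ term + ∑³ term))))  ≡⟨ six (∑³ term) ⟩
      6 * ∑<³ g                                    ∎
      where
      open ≤-Reasoning
      six : ∀ s → s + (s + (s + (s + (s + s)))) ≡ 6 * s
      six = solve-∀
      split-sum = trans (∑³-distrib-+ term _) (cong (∑³ term +_)
                  (trans (∑³-distrib-+ (λ x y z → term y x z) _) (cong (∑³ (λ x y z → term y x z) +_)
                  (trans (∑³-distrib-+ (λ x y z → term x z y) _) (cong (∑³ (λ x y z → term x z y) +_)
                  (trans (∑³-distrib-+ (λ x y z → term y z x) _) (cong (∑³ (λ x y z → term y z x) +_)
                         (∑³-distrib-+ (λ x y z → term z x y) (λ x y z → term z y x)))))))))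

-- K4s and independence number at most 2

module _ {n : ℕ} (G : Graph n) where

  isK4 : Fin n → Fin n → Fin n → Fin n → Bool
  isK4 a b c d = adj G a b ∧ adj G a c ∧ adj G a d ∧ adj G b c ∧ adj G b d ∧ adj G c d

  K4count≡∑<⁴ : K4count G ≡ ∑<⁴ (λ a b c d → 𝟙 (isK4 a b c d))
  K4count≡∑<⁴ =
    trans (sumFin≡∑ λ a → sumFin λ b → sumFin λ c → count (K a b c)) (∑-cong λ a →
    trans (sumFin≡∑ λ b → sumFin λ c → count (K a b c)) (∑-cong λ b →
    trans (sumFin≡∑ λ c → count (K a b c)) (∑-cong λ c →
    trans (count≡∑ (K a b c)) (∑-cong λ d → sym (sorted-∧ a b c d)))))
    where
    K : Fin n → Fin n → Fin n → Fin n → Bool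
    K a b c d = (a <F b) ∧ (b <F c) ∧ (c <F d) ∧ isK4 a b c d
    sorted-∧ : ∀ a b c d → 𝟙 (sorted₄ a b c d) * 𝟙 (isK4 a b c d)
             ≡ 𝟙 ((a <F b) ∧ (b <F c) ∧ (c <F d) ∧ isK4 a b c d)
    sorted-∧ a b c d = trans (sym (𝟙-∧ (sorted₄ a b c d) (isK4 a b c d)))
      (cong 𝟙 (trans (∧-assoc (a <F b) _ _) (cong ((a <F b) ∧_) (∧-assoc (b <F c) _ _))))

  private
    perm₀₁ : ∀ x₁ x₂ x₃ x₄ x₅ x₆ → (x₁ ∧ x₄ ∧ x₅ ∧ x₂ ∧ x₃ ∧ x₆) ≡ (x₁ ∧ x₂ ∧ x₃ ∧ x₄ ∧ x₅ ∧ x₆)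
    perm₀₁ = solve 6 (λ x₁ x₂ x₃ x₄ x₅ x₆ → x₁ ∙ x₄ ∙ x₅ ∙ x₂ ∙ x₃ ∙ x₆ ⊜ x₁ ∙ x₂ ∙ x₃ ∙ x₄ ∙ x₅ ∙ x₆) refl

    perm₁₂ : ∀ x₁ x₂ x₃ x₄ x₅ x₆ → (x₂ ∧ x₁ ∧ x₃ ∧ x₄ ∧ x₆ ∧ x₅) ≡ (x₁ ∧ x₂ ∧ x₃ ∧ x₄ ∧ x₅ ∧ x₆)
    perm₁₂ = solve 6 (λ x₁ x₂ x₃ x₄ x₅ x₆ → x₂ ∙ x₁ ∙ x₃ ∙ x₄ ∙ x₆ ∙ x₅ ⊜ x₁ ∙ x₂ ∙ x₃ ∙ x₄ ∙ x₅ ∙ x₆) refl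

    perm₂₃ : ∀ x₁ x₂ x₃ x₄ x₅ x₆ → (x₁ ∧ x₃ ∧ x₂ ∧ x₅ ∧ x₄ ∧ x₆) ≡ (x₁ ∧ x₂ ∧ x₃ ∧ x₄ ∧ x₅ ∧ x₆)
    perm₂₃ = solve 6 (λ x₁ x₂ x₃ x₄ x₅ x₆ → x₁ ∙ x₃ ∙ x₂ ∙ x₅ ∙ x₄ ∙ x₆ ⊜ x₁ ∙ x₂ ∙ x₃ ∙ x₄ ∙ x₅ ∙ x₆) refl

  isK4-swap₀₁ : ∀ a b c d → isK4 b a c d ≡ isK4 a b c d
  isK4-swap₀₁ a b c d rewrite Graph.sym G b a =
    perm₀₁ (adj G a b) (adj G a c) (adj G a d) (adj G b c) (adj G b d) (adj G c d)

  isK4-swap₁₂ : ∀ a b c d → isK4 a c b d ≡ isK4 a b c d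
  isK4-swap₁₂ a b c d rewrite Graph.sym G c b =
    perm₁₂ (adj G a b) (adj G a c) (adj G a d) (adj G b c) (adj G b d) (adj G c d)

  isK4-swap₂₃ : ∀ a b c d → isK4 a b d c ≡ isK4 a b c d
  isK4-swap₂₃ a b c d rewrite Graph.sym G d c =
    perm₂₃ (adj G a b) (adj G a c) (adj G a d) (adj G b c) (adj G b d) (adj G c d)

  isK4-diagonal : ∀ a c d → isK4 a a c d ≡ false
  isK4-diagonal a c d rewrite Graph.irrefl G a = refl

  isK4-symmetric : Symmetric⁴ (λ a b c d → 𝟙 (isK4 a b c d))
  isK4-symmetric = record
    { swap₀₁   = λ a b c d → cong 𝟙 (isK4-swap₀₁ a b c d)
    ; swap₁₂   = λ a b c d → cong 𝟙 (isK4-swap₁₂ a b c d)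
    ; swap₂₃   = λ a b c d → cong 𝟙 (isK4-swap₂₃ a b c d)
    ; diagonal = λ a c d → cong 𝟙 (isK4-diagonal a c d)
    }

∣S∣≡∑ : ∀ {n} (S : Subset n) → ∣ S ∣ ≡ ∑ (𝟙 ∘ lookup S)
∣S∣≡∑ []          = refl
∣S∣≡∑ (true ∷ S)  = cong suc (∣S∣≡∑ S)
∣S∣≡∑ (false ∷ S) = ∣S∣≡∑ S

module _ {n : ℕ} (G : Graph n) (α≤2 : AlphaAtMost2 G) where

  no-independent-triple : ∀ {x y z} → x ≢ y → x ≢ z → y ≢ z →
    adj G x y ≡ false → adj G x z ≡ false → adj G y z ≡ false → ⊥
  no-independent-triple {x} {y} {z} x≢y x≢z y≢z xy xz yz = 3≰2 (≤-trans three (α≤2 S independent))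
    where
    S : Subset n
    S = ⁅ x ⁆ ∪ ⁅ y ⁆ ∪ ⁅ z ⁆
    x∈S : x ∈ S
    x∈S = x∈p∪q⁺ (inj₁ (x∈⁅x⁆ x))
    y∈S : y ∈ S
    y∈S = x∈p∪q⁺ (inj₂ (x∈p∪q⁺ (inj₁ (x∈⁅x⁆ y))))
    z∈S : z ∈ S
    z∈S = x∈p∪q⁺ (inj₂ (x∈p∪q⁺ (inj₂ (x∈⁅x⁆ z))))
    three : 3 ≤ ∣ S ∣
    three = ≤-trans (s≤s (s≤s (s≤s z≤n))) (≤-trans (s≤s (s≤s (x∈p⇒∣p-x∣<∣p∣ z∈S-x-y)))
           (≤-trans (s≤s (x∈p⇒∣p-x∣<∣p∣ y∈S-x)) (x∈p⇒∣p-x∣<∣p∣ x∈S)))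
      where
      y∈S-x = x∈p∧x≢y⇒x∈p-y y∈S (x≢y ∘ sym)
      z∈S-x-y = x∈p∧x≢y⇒x∈p-y (x∈p∧x≢y⇒x∈p-y z∈S (x≢z ∘ sym)) (y≢z ∘ sym)
    member : ∀ {w} → w ∈ S → w ≡ x ⊎ w ≡ y ⊎ w ≡ z
    member {w} w∈S with x∈p∪q⁻ ⁅ x ⁆ _ w∈S
    ... | inj₁ w∈x = inj₁ (x∈⁅y⁆⇒x≡y x w∈x)
    ... | inj₂ w∈yz with x∈p∪q⁻ ⁅ y ⁆ ⁅ z ⁆ w∈yz
    ...   | inj₁ w∈y = inj₂ (inj₁ (x∈⁅y⁆⇒x≡y y w∈y))
    ...   | inj₂ w∈z = inj₂ (inj₂ (x∈⁅y⁆⇒x≡y z w∈z))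
    independent : Independent G S
    independent a b a∈S b∈S with member a∈S | member b∈S
    ... | inj₁ refl        | inj₁ refl        = Graph.irrefl G a
    ... | inj₁ refl        | inj₂ (inj₁ refl) = xy
    ... | inj₁ refl        | inj₂ (inj₂ refl) = xz
    ... | inj₂ (inj₁ refl) | inj₁ refl        = trans (Graph.sym G a b) xy
    ... | inj₂ (inj₁ refl) | inj₂ (inj₁ refl) = Graph.irrefl G a
    ... | inj₂ (inj₁ refl) | inj₂ (inj₂ refl) = yz
    ... | inj₂ (inj₂ refl) | inj₁ refl        = trans (Graph.sym G a b) xz
    ... | inj₂ (inj₂ refl) | inj₂ (inj₁ refl) = trans (Graph.sym G a b) yz
    ... | inj₂ (inj₂ refl) | inj₂ (inj₂ refl) = Graph.irrefl G a
    3≰2 : ¬ 3 ≤ 2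
    3≰2 (s≤s (s≤s ()))

  nonneighbours-adjacent : ∀ {u x y} → u ≢ x → u ≢ y → x ≢ y →
    adj G u x ≡ false → adj G u y ≡ false → adj G x y ≡ true
  nonneighbours-adjacent {u} {x} {y} u≢x u≢y x≢y ux uy with adj G x y in xy
  ... | true  = refl
  ... | false = ⊥-elim (no-independent-triple u≢x u≢y x≢y ux uy xy)

module _ {n : ℕ} (G : Graph n) (u : Fin n) (N : Fin n → Bool) where

  rewiredAdj : Fin n → Fin n → Bool
  rewiredAdj x y = if x ==F u then not (y ==F u) ∧ N y else (if y ==F u then N x else adj G x y)

  rewire : Graph n
  rewire = record { adj = rewiredAdj ; sym = symmetric ; irrefl = irreflexive }
    where
    symmetric : ∀ x y → rewiredAdj x y ≡ rewiredAdj y x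
    symmetric x y with x ==F u | y ==F u
    ... | true  | true  = refl
    ... | true  | false = refl
    ... | false | true  = refl
    ... | false | false = Graph.sym G x y
    irreflexive : ∀ x → rewiredAdj x x ≡ false
    irreflexive x with x ==F u
    ... | true  = refl
    ... | false = Graph.irrefl G x

  rewire-away : ∀ {x y} → x ≢ u → y ≢ u → adj rewire x y ≡ adj G x y
  rewire-away x≢u y≢u rewrite ==F-≢ x≢u | ==F-≢ y≢u = refl

  rewire-at : ∀ {y} → y ≢ u → adj rewire u y ≡ N y
  rewire-at {y} y≢u rewrite ==F-refl u | ==F-≢ y≢u = refl

rewire-α≤2 : ∀ {n} (G : Graph n) → AlphaAtMost2 G → (C : Fin n → Bool) →
  (∀ x y → x ≢ y → C x ≡ true → C y ≡ true → adj G x y ≡ true) →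
  ∀ u → AlphaAtMost2 (rewire G u (not ∘ C))
rewire-α≤2 {n} G α≤2 C clique u S independent with lookup S u in u∈S?
... | false = α≤2 S λ x y x∈S y∈S →
  trans (sym (rewire-away G u (not ∘ C) (≢u x∈S) (≢u y∈S))) (independent x y x∈S y∈S)
  where
  ≢u : ∀ {x} → x ∈ S → x ≢ u
  ≢u x∈S refl with () ← trans (sym u∈S?) ([]=⇒lookup x∈S)
... | true = begin
  ∣ S ∣                               ≡⟨ trans (∣S∣≡∑ S) (sym (count≡∑ (lookup S))) ⟩
  count (lookup S)                    ≤⟨ count-cover₂ cover ⟩
  count (_==F u) + count others       ≤⟨ +-mono-≤ (≤-reflexive (count-point u)) (count-subsingleton unique) ⟩
  2                                   ∎
  where
  open ≤-Reasoning
  others : Fin n → Bool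
  others w = lookup S w ∧ not (w ==F u)
  cover : ∀ w → lookup S w ≡ true → (w ==F u) ≡ true ⊎ others w ≡ true
  cover w w∈S with w ==F u
  ... | true  = inj₁ refl
  ... | false = inj₂ (trans (∧-identityʳ _) w∈S)
  away : ∀ {w} → others w ≡ true → w ≢ u
  away ow = ==F-false⇒≢ (not-injective (∧-conicalʳ _ _ ow))
  in-clique : ∀ {x} → others x ≡ true → C x ≡ true
  in-clique {x} ox = not-injective (trans (sym (rewire-at G u (not ∘ C) (away ox)))
    (independent u x (lookup⇒[]= u S u∈S?) (lookup⇒[]= x S (∧-conicalˡ _ _ ox))))
  unique : ∀ x y → others x ≡ true → others y ≡ true → x ≡ y
  unique x y ox oy with x ≟ y
  ... | yes x≡y = x≡y
  ... | no  x≢y with () ← trans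
    (sym (independent x y (lookup⇒[]= x S (∧-conicalˡ _ _ ox)) (lookup⇒[]= y S (∧-conicalˡ _ _ oy))))
    (trans (rewire-away G u (not ∘ C) (away ox) (away oy)) (clique x y x≢y (in-clique ox) (in-clique oy)))

isK4-intro : ∀ {n} (G : Graph n) {a b c d} → adj G a b ≡ true → adj G a c ≡ true → adj G a d ≡ true →
             adj G b c ≡ true → adj G b d ≡ true → adj G c d ≡ true → isK4 G a b c d ≡ true
isK4-intro G ab ac ad bc bd cd rewrite ab | ac | ad | bc | bd | cd = refl

-- Rewiring a vertex of a K4-minimiser

module _ {n : ℕ} where

  ∑<³-trade : (p q : Fin n → Fin n → Fin n → Bool) →
    ∑<³ (λ x y z → 𝟙 (p x y z)) ≤ ∑<³ (λ x y z → 𝟙 (q x y z)) →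
    ∑<³ (λ x y z → 𝟙 (p x y z ∧ not (q x y z))) ≤ ∑<³ (λ x y z → 𝟙 (q x y z ∧ not (p x y z)))
  ∑<³-trade p q p≤q = +-cancelˡ-≤ (∑<³ (𝟙₃ q)) _ _ (begin
    ∑<³ (𝟙₃ q) + ∑<³ (λ x y z → 𝟙 (p x y z ∧ not (q x y z)))
      ≡⟨ ∑<³-distrib-+ (𝟙₃ q) (λ x y z → 𝟙 (p x y z ∧ not (q x y z))) ⟨
    ∑<³ (λ x y z → 𝟙 (q x y z) + 𝟙 (p x y z ∧ not (q x y z)))
      ≡⟨ ∑<³-cong (λ x y z → exchange (p x y z) (q x y z)) ⟩
    ∑<³ (λ x y z → 𝟙 (p x y z) + 𝟙 (q x y z ∧ not (p x y z)))
      ≡⟨ ∑<³-distrib-+ (𝟙₃ p) (λ x y z → 𝟙 (q x y z ∧ not (p x y z))) ⟩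
    ∑<³ (𝟙₃ p) + ∑<³ (λ x y z → 𝟙 (q x y z ∧ not (p x y z)))
      ≤⟨ +-monoˡ-≤ _ p≤q ⟩
    ∑<³ (𝟙₃ q) + ∑<³ (λ x y z → 𝟙 (q x y z ∧ not (p x y z))) ∎)
    where
    open ≤-Reasoning
    𝟙₃ : (Fin n → Fin n → Fin n → Bool) → Fun³ n
    𝟙₃ r x y z = 𝟙 (r x y z)
    exchange : ∀ a b → 𝟙 b + 𝟙 (a ∧ not b) ≡ 𝟙 a + 𝟙 (b ∧ not a)
    exchange true  true  = refl
    exchange true  false = refl
    exchange false true  = refl
    exchange false false = refl

newNeighbour : ∀ {n} → Graph n → Graph n → Fin n → Fin n → Bool
newNeighbour H H′ u w = adj H′ u w ∧ not (adj H u w)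

module _ {n : ℕ} (H H′ : Graph n) (u : Fin n)
         (agree : ∀ {x y} → x ≢ u → y ≢ u → adj H x y ≡ adj H′ x y) where

  private
    K4 K4′ : Fun⁴ n
    K4  a b c d = 𝟙 (isK4 H a b c d)
    K4′ a b c d = 𝟙 (isK4 H′ a b c d)

    K4-away : ∀ a b c d → a ≢ u → b ≢ u → c ≢ u → d ≢ u → K4 a b c d ≡ K4′ a b c d
    K4-away a b c d a≢u b≢u c≢u d≢u
      rewrite agree a≢u b≢u | agree a≢u c≢u | agree a≢u d≢u | agree b≢u c≢u | agree b≢u d≢u | agree c≢u d≢u = refl

  link-≤ : K4count H ≤ K4count H′ → ∑<³ (K4 u) ≤ ∑<³ (K4′ u)
  link-≤ H≤H′ = +-cancelˡ-≤ (∑⁴ (avoidingPart u K4)) _ _ (begin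
    ∑⁴ (avoidingPart u K4) + ∑<³ (K4 u)    ≡⟨ link-decomposition u (isK4-symmetric H) ⟨
    ∑<⁴ K4                                ≡⟨ K4count≡∑<⁴ H ⟨
    K4count H                             ≤⟨ H≤H′ ⟩
    K4count H′                            ≡⟨ K4count≡∑<⁴ H′ ⟩
    ∑<⁴ K4′                               ≡⟨ link-decomposition u (isK4-symmetric H′) ⟩
    ∑⁴ (avoidingPart u K4′) + ∑<³ (K4′ u)  ≡⟨ cong (_+ ∑<³ (K4′ u)) (avoidingPart-cong u K4-away) ⟨
    ∑⁴ (avoidingPart u K4) + ∑<³ (K4′ u)   ∎)
    where open ≤-Reasoning

  new : Fin n → Bool
  new = newNeighbour H H′ u

  private
    all₆ : ∀ {p q r s t w} → p ∧ q ∧ r ∧ s ∧ t ∧ w ≡ true →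
           p ≡ true × q ≡ true × r ≡ true × s ≡ true × t ≡ true × w ≡ true
    all₆ {true} {true} {true} {true} {true} {true} refl = refl , refl , refl , refl , refl , refl

    away : ∀ {x} → adj H′ u x ≡ true → x ≢ u
    away {x} ux refl with () ← trans (sym ux) (Graph.irrefl H′ u)

    decide : ∀ b → b ≡ false ⊎ b ≡ true
    decide false = inj₁ refl
    decide true  = inj₂ refl

    becomes-new : ∀ {x} → adj H′ u x ≡ true → adj H u x ≡ false → new x ≡ true
    becomes-new ux hx = cong₂ (λ a b → a ∧ not b) ux hx

    gained-new : ∀ x y z → (isK4 H′ u x y z ∧ not (isK4 H u x y z)) ≡ true →
                 new x ≡ true ⊎ new y ≡ true ⊎ new z ≡ true
    gained-new x y z gained with all₆ (∧-conicalˡ _ _ gained)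
    ... | ux , uy , uz , xy , xz , yz with decide (adj H u x) | decide (adj H u y) | decide (adj H u z)
    ... | inj₁ hx | _       | _       = inj₁ (becomes-new ux hx)
    ... | inj₂ _  | inj₁ hy | _       = inj₂ (inj₁ (becomes-new uy hy))
    ... | inj₂ _  | inj₂ _  | inj₁ hz = inj₂ (inj₂ (becomes-new uz hz))
    ... | inj₂ hx | inj₂ hy | inj₂ hz with () ← trans
      (sym (isK4-intro H hx hy hz (trans (agree (away ux) (away uy)) xy)
                                  (trans (agree (away ux) (away uz)) xz) (trans (agree (away uy) (away uz)) yz)))
      (not-injective {y = false} (∧-conicalʳ _ _ gained))

  gained-bound : ∑³ (λ x y z → 𝟙 (isK4 H′ u x y z ∧ not (isK4 H u x y z))) ≤ 3 * (count new * (n * n))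
  gained-bound = begin
    ∑³ (λ x y z → 𝟙 (isK4 H′ u x y z ∧ not (isK4 H u x y z)))
      ≤⟨ ∑³-mono-≤ (λ x y z → 𝟙-cover₃ (gained-new x y z)) ⟩
    ∑³ (λ x y z → 𝟙 (new x) + 𝟙 (new y) + 𝟙 (new z))
      ≡⟨ trans (∑³-distrib-+ (λ x y z → 𝟙 (new x) + 𝟙 (new y)) (λ x y z → 𝟙 (new z)))
               (cong (_+ ∑³ (λ x y z → 𝟙 (new z))) (∑³-distrib-+ (λ x y z → 𝟙 (new x)) (λ x y z → 𝟙 (new y)))) ⟩
    ∑³ (λ x y z → 𝟙 (new x)) + ∑³ (λ x y z → 𝟙 (new y)) + ∑³ (λ x y z → 𝟙 (new z))
      ≡⟨ cong₂ _+_ (cong (∑³ (λ x y z → 𝟙 (new x)) +_) (∑³-swap₀₁ λ x y z → 𝟙 (new x)))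
                   (∑³-rotate⁻¹ λ x y z → 𝟙 (new x)) ⟩
    ∑³ (λ x y z → 𝟙 (new x)) + ∑³ (λ x y z → 𝟙 (new x)) + ∑³ (λ x y z → 𝟙 (new x))
      ≡⟨ cong (λ s → s + s + s) (trans (∑³-first (𝟙 ∘ new)) (cong (_* (n * n)) (sym (count≡∑ new)))) ⟩
    count new * (n * n) + count new * (n * n) + count new * (n * n)
      ≡⟨ thrice (count new * (n * n)) ⟩
    3 * (count new * (n * n)) ∎
    where
    open ≤-Reasoning
    thrice : ∀ s → s + s + s ≡ 3 * s
    thrice = solve-∀

  private
    lost : Fin n → Fin n → Fin n → Bool
    lost x y z = isK4 H u x y z ∧ not (isK4 H′ u x y z)

    lost-symmetric : Symmetric³ (λ x y z → 𝟙 (lost x y z))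
    lost-symmetric = record
      { swap₀₁   = λ x y z → cong 𝟙 (cong₂ (λ a b → a ∧ not b) (isK4-swap₁₂ H u x y z) (isK4-swap₁₂ H′ u x y z))
      ; swap₁₂   = λ x y z → cong 𝟙 (cong₂ (λ a b → a ∧ not b) (isK4-swap₂₃ H u x y z) (isK4-swap₂₃ H′ u x y z))
      ; diagonal = λ x z → cong (λ b → 𝟙 (b ∧ not (isK4 H′ u x x z)))
          (trans (isK4-swap₀₁ H x u x z) (trans (isK4-swap₁₂ H x x u z) (isK4-diagonal H x u z)))
      }

  -- Each K4 through u that the modification destroys is paid for by one it creates.
  key-estimate : K4count H ≤ K4count H′ → (P Q : Fin n → Bool) →
    (∀ x y z → P x ≡ true → Q y ≡ true → Q z ≡ true → y ≢ z → isK4 H u x y z ≡ true × adj H′ u x ≡ false) →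
    count P * (count Q * (count Q ∸ 1)) ≤ 18 * (count new * (n * n))
  key-estimate H≤H′ P Q destroyed = begin
    count P * (count Q * (count Q ∸ 1))           ≤⟨ count-triples P Q lost lost-PQQ ⟩
    ∑³ (λ x y z → 𝟙 (lost x y z))                 ≤⟨ ∑³≤6*∑<³ lost-symmetric ⟩
    6 * ∑<³ (λ x y z → 𝟙 (lost x y z))            ≤⟨ *-monoʳ-≤ 6 (∑<³-trade (isK4 H u) (isK4 H′ u) (link-≤ H≤H′)) ⟩
    6 * ∑<³ (λ x y z → 𝟙 (gained x y z))          ≤⟨ *-monoʳ-≤ 6 (∑<³≤∑³ λ x y z → 𝟙 (gained x y z)) ⟩
    6 * ∑³ (λ x y z → 𝟙 (gained x y z))           ≤⟨ *-monoʳ-≤ 6 gained-bound ⟩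
    6 * (3 * (count new * (n * n)))               ≡⟨ *-assoc 6 3 (count new * (n * n)) ⟨
    18 * (count new * (n * n))                    ∎
    where
    open ≤-Reasoning
    gained : Fin n → Fin n → Fin n → Bool
    gained x y z = isK4 H′ u x y z ∧ not (isK4 H u x y z)
    lost-PQQ : ∀ x y z → P x ≡ true → Q y ≡ true → Q z ≡ true → y ≢ z → lost x y z ≡ true
    lost-PQQ x y z px qy qz y≢z with destroyed x y z px qy qz y≢z
    ... | K4 , cut rewrite K4 | cut = refl

-- Arithmetic and little-o

cancel-square : ∀ {n a b z} → 1 ≤ n → n ≤ 10 * (a ∸ 1) → b * (a * (a ∸ 1)) ≤ 18 * (z * (n * n)) → b ≤ 1800 * z
cancel-square {suc m} {a} {b} {z} _ n≤ b≤ = *-cancelʳ-≤ b (1800 * z) (n * n) (begin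
  b * (n * n)                   ≤⟨ *-monoʳ-≤ b (*-mono-≤ (≤-trans n≤ (*-monoʳ-≤ 10 (m∸n≤m a 1))) n≤) ⟩
  b * ((10 * a) * (10 * (a ∸ 1)))  ≡⟨ reorder b a (a ∸ 1) ⟩
  100 * (b * (a * (a ∸ 1)))     ≤⟨ *-monoʳ-≤ 100 b≤ ⟩
  100 * (18 * (z * (n * n)))    ≡⟨ regroup z (n * n) ⟩
  1800 * z * (n * n)            ∎)
  where
  open ≤-Reasoning
  n = suc m
  reorder : ∀ b a a′ → b * ((10 * a) * (10 * a′)) ≡ 100 * (b * (a * a′))
  reorder = solve-∀
  regroup : ∀ z m → 100 * (18 * (z * m)) ≡ 1800 * z * m
  regroup = solve-∀

module _ {n h s t : ℕ} (large : 18005 * (h + s + t) + 10 ≤ n) where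

  most-remain : ∀ {V A M} → n ≤ 5 * V + 5 * s → V ≤ A + M → M ≤ h + h → n ≤ 10 * (A ∸ 1)
  most-remain {V} {A} {M} n≤ V≤ M≤ = subst (n ≤_) (sym (*-distribˡ-∸ 10 A 1))
    (m+n≤o⇒m≤o∸n n (+-cancelʳ-≤ (20 * h + 10 * s) (n + 10) (10 * A) (begin
      n + 10 + (20 * h + 10 * s)   ≡⟨ shuffle n h s ⟩
      n + (20 * h + 10 * s + 10)   ≤⟨ +-monoʳ-≤ n (≤-trans (+-monoˡ-≤ 10 (bound h s t)) large) ⟩
      n + n                        ≤⟨ +-mono-≤ n≤ n≤ ⟩
      (5 * V + 5 * s) + (5 * V + 5 * s)
        ≤⟨ +-mono-≤ (+-monoˡ-≤ (5 * s) (*-monoʳ-≤ 5 V≤′)) (+-monoˡ-≤ (5 * s) (*-monoʳ-≤ 5 V≤′)) ⟩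
      (5 * (A + (h + h)) + 5 * s) + (5 * (A + (h + h)) + 5 * s) ≡⟨ collect A h s ⟩
      10 * A + (20 * h + 10 * s)   ∎)))
    where
    open ≤-Reasoning
    V≤′ = ≤-trans V≤ (+-monoʳ-≤ A M≤)
    shuffle : ∀ n h s → n + 10 + (20 * h + 10 * s) ≡ n + (20 * h + 10 * s + 10)
    shuffle = solve-∀
    bound : ∀ h s t → 20 * h + 10 * s ≤ 18005 * (h + s + t)
    bound h s t = ≤-trans (m≤m+n (20 * h + 10 * s) (17985 * h + 17995 * s + 18005 * t)) (≤-reflexive (split h s t))
      where
      split : ∀ h s t → 20 * h + 10 * s + (17985 * h + 17995 * s + 18005 * t) ≡ 18005 * (h + s + t)
      split = solve-∀
    collect : ∀ A h s → (5 * (A + (h + h)) + 5 * s) + (5 * (A + (h + h)) + 5 * s) ≡ 10 * A + (20 * h + 10 * s)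
    collect = solve-∀

  many-missing : ∀ {V B M z} → n ≤ 5 * V + 5 * s → V ≤ B + M → B ≤ 1800 * z → z ≤ h + h + t → h < M
  many-missing {V} {B} {M} {z} n≤ V≤ B≤ z≤ = ≰⇒> λ M≤h → <-irrefl refl (begin-strict
    n                                         ≤⟨ n≤ ⟩
    5 * V + 5 * s
      ≤⟨ +-monoˡ-≤ (5 * s) (*-monoʳ-≤ 5 (≤-trans V≤ (+-mono-≤ (≤-trans B≤ (*-monoʳ-≤ 1800 z≤)) M≤h))) ⟩
    5 * (1800 * (h + h + t) + h) + 5 * s
      ≡⟨ expand h s t ⟩
    18005 * h + 9000 * t + 5 * s
      ≤⟨ +-mono-≤ (+-monoʳ-≤ (18005 * h) (*-monoˡ-≤ t (m≤m+n 9000 9005))) (*-monoˡ-≤ s (m≤m+n 5 18000)) ⟩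
    18005 * h + 18005 * t + 18005 * s
      ≡⟨ collect h s t ⟩
    18005 * (h + s + t)
      <⟨ ≤-trans (≤-trans (≤-reflexive (+-comm 1 _)) (+-monoʳ-≤ (18005 * (h + s + t)) (s≤s z≤n))) large ⟩
    n ∎)
    where
    open ≤-Reasoning
    expand : ∀ h s t → 5 * (1800 * (h + h + t) + h) + 5 * s ≡ 18005 * h + 9000 * t + 5 * s
    expand = solve-∀
    collect : ∀ h s t → 18005 * h + 18005 * t + 18005 * s ≡ 18005 * (h + s + t)
    collect = solve-∀

private
  halves : ∀ a b {n} → 2 * a ≤ n → 2 * b ≤ n → a + b ≤ n
  halves a b {n} a≤ b≤ = *-cancelˡ-≤ 2 (begin
    2 * (a + b)   ≡⟨ *-distribˡ-+ 2 a b ⟩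
    2 * a + 2 * b ≤⟨ +-mono-≤ a≤ b≤ ⟩
    n + n         ≡⟨ cong (n +_) (sym (+-identityʳ n)) ⟩
    2 * n         ∎)
    where open ≤-Reasoning

  left : ∀ m n {o} → m ⊔ n ≤ o → m ≤ o
  left m n le = ≤-trans (m≤m⊔n m n) le

  right : ∀ m n {o} → m ⊔ n ≤ o → n ≤ o
  right m n le = ≤-trans (m≤n⊔m m n) le

LittleO-+ : ∀ {f g} → LittleO f → LittleO g → LittleO (λ n → f n + g n)
LittleO-+ {f} {g} f-o g-o k with f-o (2 * k) | g-o (2 * k)
... | N₁ , f-small | N₂ , g-small = N₁ ⊔ N₂ , λ n N≤n →
  ≤-trans (≤-reflexive (*-distribˡ-+ k (f n) (g n)))
          (halves (k * f n) (k * g n)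
                  (≤-trans (≤-reflexive (sym (*-assoc 2 k (f n)))) (f-small n (left N₁ N₂ N≤n)))
                  (≤-trans (≤-reflexive (sym (*-assoc 2 k (g n)))) (g-small n (right N₁ N₂ N≤n))))

LittleO-scale : ∀ c {f} → LittleO f → LittleO (λ n → c * f n)
LittleO-scale c {f} f-o k with f-o (k * c)
... | N , f-small = N , λ n N≤n → ≤-trans (≤-reflexive (sym (*-assoc k c (f n)))) (f-small n N≤n)

LittleO-eventually : ∀ {f} → LittleO f → ∀ c d → ∃ λ N → ∀ n → N ≤ n → c * f n + d ≤ n
LittleO-eventually {f} f-o c d with f-o (2 * c)
... | N , f-small = N ⊔ (2 * d) , λ n N≤n →
  halves (c * f n) d (≤-trans (≤-reflexive (sym (*-assoc 2 c (f n)))) (f-small n (left N (2 * d) N≤n)))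
                     (right N (2 * d) N≤n)

-- The parts V₀, …, V₄ (indices modulo 5) and U

_⊕_ : Fin 5 → ℕ → Fin 5
_⊕_ = shift

pair : Fin 5 → List (Fin 5)
pair k = k ∷ k ⊕ 1 ∷ []

inIdx⁺ : ∀ {l ks} → l ∈ˡ ks → inIdx (just l) ks ≡ true
inIdx⁺ {l} (here refl)         rewrite ==F-refl l = refl
inIdx⁺ {l} {k ∷ _} (there l∈ks) rewrite inIdx⁺ l∈ks = ∨-zeroʳ (l ==F k)

inIdx⁻ : ∀ {L} ks → inIdx L ks ≡ true → ∃ λ l → L ≡ just l × l ∈ˡ ks
inIdx⁻ {just l} (k ∷ ks) l∈? with l ==F k in l=k
... | true  = l , refl , here (==F-≡ l=k)
... | false with inIdx⁻ ks l∈?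
...   | l′ , refl , l∈ks = l′ , refl , there l∈ks

k≢k⊕2 : ∀ k → k ≢ k ⊕ 2
k≢k⊕2 = from-yes (all? λ k → ¬? (k ≟ k ⊕ 2))

k≢k⊕3 : ∀ k → k ≢ k ⊕ 3
k≢k⊕3 = from-yes (all? λ k → ¬? (k ≟ k ⊕ 3))

k⊕2≢k⊕3 : ∀ k → k ⊕ 2 ≢ k ⊕ 3
k⊕2≢k⊕3 = from-yes (all? λ k → ¬? (k ⊕ 2 ≟ k ⊕ 3))

k⊕4⊕4 : ∀ k → (k ⊕ 4) ⊕ 4 ≡ k ⊕ 3
k⊕4⊕4 = from-yes (all? λ k → (k ⊕ 4) ⊕ 4 ≟ k ⊕ 3)

k≢k⊕4 : ∀ k → k ≢ k ⊕ 4
k≢k⊕4 = from-yes (all? λ k → ¬? (k ≟ k ⊕ 4))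

k⊕1≢k⊕2 : ∀ k → k ⊕ 1 ≢ k ⊕ 2
k⊕1≢k⊕2 = from-yes (all? λ k → ¬? (k ⊕ 1 ≟ k ⊕ 2))

k⊕4⊕1 : ∀ k → (k ⊕ 4) ⊕ 1 ≡ k
k⊕4⊕1 = from-yes (all? λ k → (k ⊕ 4) ⊕ 1 ≟ k)

k⊕1⊕1 : ∀ k → (k ⊕ 1) ⊕ 1 ≡ k ⊕ 2
k⊕1⊕1 = from-yes (all? λ k → (k ⊕ 1) ⊕ 1 ≟ k ⊕ 2)

k⊕3⊕2 : ∀ k → (k ⊕ 3) ⊕ 2 ≡ k
k⊕3⊕2 = from-yes (all? λ k → (k ⊕ 3) ⊕ 2 ≟ k)

k⊕3⊕3 : ∀ k → (k ⊕ 3) ⊕ 3 ≡ k ⊕ 1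
k⊕3⊕3 = from-yes (all? λ k → (k ⊕ 3) ⊕ 3 ≟ k ⊕ 1)

k⊕3⊕4⊕3 : ∀ k → ((k ⊕ 3) ⊕ 4) ⊕ 3 ≡ k
k⊕3⊕4⊕3 = from-yes (all? λ k → ((k ⊕ 3) ⊕ 4) ⊕ 3 ≟ k)

k⊕3⊕1⊕2 : ∀ k → ((k ⊕ 3) ⊕ 1) ⊕ 2 ≡ k ⊕ 1
k⊕3⊕1⊕2 = from-yes (all? λ k → ((k ⊕ 3) ⊕ 1) ⊕ 2 ≟ k ⊕ 1)

every-index : ∀ j l → l ≡ j ⊎ l ≡ j ⊕ 1 ⊎ l ≡ j ⊕ 2 ⊎ l ≡ j ⊕ 3 ⊎ l ≡ j ⊕ 4
every-index = from-yes (all? λ j → all? λ l →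
  (l ≟ j) ⊎-dec (l ≟ j ⊕ 1) ⊎-dec (l ≟ j ⊕ 2) ⊎-dec (l ≟ j ⊕ 3) ⊎-dec (l ≟ j ⊕ 4))

module _ (h : ℕ) (m : Fin 5 → ℕ) (dichotomy : ∀ k → m k ≡ 0 ⊎ m (k ⊕ 2) + m (k ⊕ 3) ≤ h) where

  private
    from-bound : ∀ k → m (k ⊕ 2) + m (k ⊕ 3) ≤ h → ∃ λ j → m (j ⊕ 2) + m (j ⊕ 3) + m (j ⊕ 4) ≤ h + h
    from-bound k bound with dichotomy (k ⊕ 4)
    ... | inj₁ empty = k , ≤-trans (≤-reflexive (trans (cong (m (k ⊕ 2) + m (k ⊕ 3) +_) empty) (+-identityʳ _)))
                                   (≤-trans bound (m≤m+n h h))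
    ... | inj₂ bound′ = k ⊕ 4 , +-mono-≤ bound′
      (≤-trans (≤-reflexive (cong m (k⊕4⊕4 k))) (≤-trans (m≤n+m (m (k ⊕ 3)) (m (k ⊕ 2))) bound))

  five-cycle-choice : ∃ λ j → m (j ⊕ 2) + m (j ⊕ 3) + m (j ⊕ 4) ≤ h + h
  five-cycle-choice with dichotomy (# 0) | dichotomy (# 1) | dichotomy (# 2) | dichotomy (# 3) | dichotomy (# 4)
  ... | inj₂ bound | _ | _ | _ | _ = from-bound (# 0) bound
  ... | _ | inj₂ bound | _ | _ | _ = from-bound (# 1) bound
  ... | _ | _ | inj₂ bound | _ | _ = from-bound (# 2) bound
  ... | _ | _ | _ | inj₂ bound | _ = from-bound (# 3) bound
  ... | _ | _ | _ | _ | inj₂ bound = from-bound (# 4) bound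
  ... | inj₁ _ | inj₁ _ | inj₁ m₂ | inj₁ m₃ | inj₁ m₄ =
    # 0 , ≤-trans (≤-reflexive (cong₂ _+_ (cong₂ _+_ m₂ m₃) m₄)) z≤n

module _ {n : ℕ} (G : Graph n) (ℓ : Fin n → Label) where

  inV : Fin 5 → Fin n → Bool
  inV k w = inIdx (ℓ w) (k ∷ [])

  inV⁻ : ∀ {k w} → inV k w ≡ true → ℓ w ≡ just k
  inV⁻ {k} {w} k∋w with inIdx⁻ (k ∷ []) k∋w
  ... | _ , ℓw , here refl = ℓw

  labelled⁺ : ∀ {k w ks} → ℓ w ≡ just k → k ∈ˡ ks → inIdx (ℓ w) ks ≡ true
  labelled⁺ ℓw k∈ks rewrite ℓw = inIdx⁺ k∈ks

  different-labels : ∀ {v w k k′} → ℓ v ≡ just k → ℓ w ≡ just k′ → k ≢ k′ → v ≢ w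
  different-labels ℓv ℓw k≢k′ refl = k≢k′ (just-injective (trans (sym ℓv) ℓw))

  inV⁺ : ∀ {k w} → ℓ w ≡ just k → inV k w ≡ true
  inV⁺ ℓw = labelled⁺ ℓw (here refl)

  module _ (u : Fin n) (u∈U : ℓ u ≡ nothing) where

    labelled≢u : ∀ {w k} → ℓ w ≡ just k → w ≢ u
    labelled≢u ℓw refl with () ← trans (sym u∈U) ℓw

    missing seen : Fin 5 → ℕ
    missing k = count λ w → inV k w ∧ not (adj G u w)
    seen    k = count λ w → inV k w ∧ adj G u w

    inV-disjoint : ∀ {k k′ w} → k ≢ k′ → inV k w ≡ true → inV k′ w ≡ false
    inV-disjoint {k} {k′} {w} k≢k′ k∋w rewrite inV⁻ k∋w | ==F-≢ k≢k′ = refl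

    module _ (α≤2 : AlphaAtMost2 G) {h : ℕ} (degree : DegreeCond G ℓ h) where

      -- Non-neighbours of u are pairwise adjacent, so m is adjacent to those in V_{k+2} ∪ V_{k+3}.
      missing-far : ∀ {k m} → ℓ m ≡ just k → adj G u m ≡ false → missing (k ⊕ 2) + missing (k ⊕ 3) ≤ h
      missing-far {k} {m} ℓm um = ≤-trans
        (count-disjoint-∪ (far-adjacent (here refl) (k≢k⊕2 k)) (far-adjacent (there (here refl)) (k≢k⊕3 k))
                          (λ w w∈ → cong (_∧ _) (inV-disjoint (k⊕2≢k⊕3 k) (∧-conicalˡ _ _ w∈))))
        (proj₂ (degree k m ℓm))
        where
        far-adjacent : ∀ {k′} → k′ ∈ˡ far k → k ≢ k′ → ∀ w → (inV k′ w ∧ not (adj G u w)) ≡ true →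
                       (inIdx (ℓ w) (far k) ∧ adj G m w) ≡ true
        far-adjacent k′∈far k≢k′ w w∈ = cong₂ _∧_ (labelled⁺ ℓw k′∈far)
          (nonneighbours-adjacent G α≤2 (labelled≢u ℓm ∘ sym) (labelled≢u ℓw ∘ sym) (different-labels ℓm ℓw k≢k′)
                                  um (not-injective (∧-conicalʳ _ _ w∈)))
          where ℓw = inV⁻ (∧-conicalˡ _ _ w∈)

      missing-far₂ : ∀ {k m} → ℓ m ≡ just k → adj G u m ≡ false → missing (k ⊕ 2) ≤ h
      missing-far₂ {k} ℓm um = ≤-trans (m≤m+n (missing (k ⊕ 2)) (missing (k ⊕ 3))) (missing-far ℓm um)

      missing-far₃ : ∀ {k m} → ℓ m ≡ just k → adj G u m ≡ false → missing (k ⊕ 3) ≤ h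
      missing-far₃ {k} ℓm um = ≤-trans (m≤n+m (missing (k ⊕ 3)) (missing (k ⊕ 2))) (missing-far ℓm um)

      missing-dichotomy : ∀ k → missing k ≡ 0 ⊎ missing (k ⊕ 2) + missing (k ⊕ 3) ≤ h
      missing-dichotomy k with count-witness (λ w → inV k w ∧ not (adj G u w))
      ... | inj₁ none      = inj₁ none
      ... | inj₂ (m , m∈)  = inj₂ (missing-far (inV⁻ (∧-conicalˡ _ _ m∈)) (not-injective (∧-conicalʳ _ _ m∈)))

      module Rewired (clique : CliqueCond G ℓ) (minimal : K4Minimizer G) (j : Fin 5) where

        inPair : Fin n → Bool
        inPair w = inIdx (ℓ w) (pair j)

        G′ : Graph n
        G′ = rewire G u (not ∘ inPair)

        G≤G′ : K4count G ≤ K4count G′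
        G≤G′ = minimal G′ (rewire-α≤2 G α≤2 inPair (clique j) u)

        agree : ∀ {x y} → x ≢ u → y ≢ u → adj G x y ≡ adj G′ x y
        agree x≢u y≢u = sym (rewire-away G u (not ∘ inPair) x≢u y≢u)

        seen-product : ∀ {p r k} → p ∈ˡ (pair j) → p ∈ˡ (pair k) → r ∈ˡ (pair k) → p ≢ r →
          seen p * (seen r * (seen r ∸ 1)) ≤ 18 * (count (newNeighbour G G′ u) * (n * n))
        seen-product {p} {r} {k} p∈j p∈k r∈k p≢r =
          key-estimate G G′ u agree G≤G′ (λ w → inV p w ∧ adj G u w) (λ w → inV r w ∧ adj G u w) destroyed
          where
          destroyed : ∀ x y z → (inV p x ∧ adj G u x) ≡ true → (inV r y ∧ adj G u y) ≡ true →
                      (inV r z ∧ adj G u z) ≡ true → y ≢ z → isK4 G u x y z ≡ true × adj G′ u x ≡ false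
          destroyed x y z x∈ y∈ z∈ y≢z =
            isK4-intro G (∧-conicalʳ _ _ x∈) (∧-conicalʳ _ _ y∈) (∧-conicalʳ _ _ z∈)
              (clique k x y (different-labels ℓx ℓy p≢r) (labelled⁺ ℓx p∈k) (labelled⁺ ℓy r∈k))
              (clique k x z (different-labels ℓx ℓz p≢r) (labelled⁺ ℓx p∈k) (labelled⁺ ℓz r∈k))
              (clique k y z y≢z (labelled⁺ ℓy r∈k) (labelled⁺ ℓz r∈k))
            , trans (rewire-at G u (not ∘ inPair) (labelled≢u ℓx)) (cong not (labelled⁺ ℓx p∈j))
            where
            ℓx = inV⁻ (∧-conicalˡ _ _ x∈)
            ℓy = inV⁻ (∧-conicalˡ _ _ y∈)
            ℓz = inV⁻ (∧-conicalˡ _ _ z∈)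

        new-few : count (newNeighbour G G′ u)
                ≤ missing (j ⊕ 2) + missing (j ⊕ 3) + missing (j ⊕ 4) + count (isU ∘ ℓ)
        new-few = count-cover₄ cover
          where
          Missed : Fin 5 → Fin n → Set
          Missed k w = (inV k w ∧ not (adj G u w)) ≡ true
          cover : ∀ w → newNeighbour G G′ u w ≡ true →
                  Missed (j ⊕ 2) w ⊎ Missed (j ⊕ 3) w ⊎ Missed (j ⊕ 4) w ⊎ isU (ℓ w) ≡ true
          cover w new = by-label (ℓ w) refl
            where
            G′uw = ∧-conicalˡ _ _ new
            Guw = not-injective {y = false} (∧-conicalʳ _ _ new)
            w≢u : w ≢ u
            w≢u refl with () ← trans (sym G′uw) (Graph.irrefl G′ u)
            outside : inPair w ≡ false
            outside = not-injective {y = false} (trans (sym (rewire-at G u (not ∘ inPair) w≢u)) G′uw)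
            missed : ∀ {k} → ℓ w ≡ just k → Missed k w
            missed ℓw = cong₂ _∧_ (inV⁺ ℓw) (cong not Guw)
            by-label : ∀ L → ℓ w ≡ L →
                       Missed (j ⊕ 2) w ⊎ Missed (j ⊕ 3) w ⊎ Missed (j ⊕ 4) w ⊎ isU (ℓ w) ≡ true
            by-label nothing ℓw = inj₂ (inj₂ (inj₂ (cong isU ℓw)))
            by-label (just l) ℓw with every-index j l
            ... | inj₁ refl with () ← trans (sym outside) (labelled⁺ ℓw (here refl))
            ... | inj₂ (inj₁ refl) with () ← trans (sym outside) (labelled⁺ ℓw (there (here refl)))
            ... | inj₂ (inj₂ (inj₁ refl)) = inj₁ (missed ℓw)
            ... | inj₂ (inj₂ (inj₂ (inj₁ refl))) = inj₂ (inj₁ (missed ℓw))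
            ... | inj₂ (inj₂ (inj₂ (inj₂ refl))) = inj₂ (inj₂ (inj₁ (missed ℓw)))

      module Attach (clique : CliqueCond G ℓ) (minimal : K4Minimizer G) {s t : ℕ}
               (size : SizeCond ℓ s) (few-U : USizeCond ℓ t) (large : 18005 * (h + s + t) + 10 ≤ n)
               (j : Fin 5) (few : missing (j ⊕ 2) + missing (j ⊕ 3) + missing (j ⊕ 4) ≤ h + h) where

        open Rewired clique minimal j

        z : ℕ
        z = count (newNeighbour G G′ u)

        z≤ : z ≤ h + h + t
        z≤ = ≤-trans new-few (+-mono-≤ few few-U)

        split : ∀ k → count (inV k) ≤ seen k + missing k
        split k = ≤-reflexive (count-split (inV k) (adj G u))

        seen-bound : ∀ {p r k} → p ∈ˡ (pair j) → p ∈ˡ (pair k) → r ∈ˡ (pair k) → p ≢ r →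
                     missing r ≤ h + h → seen p ≤ 1800 * z
        seen-bound {p} {r} p∈j p∈k r∈k p≢r few-r =
          cancel-square {n} {seen r} {seen p} {z}
            (≤-trans (s≤s z≤n) (≤-trans (m≤n+m 10 (18005 * (h + s + t))) large))
            (most-remain {n} {h} {s} {t} large {count (inV r)} {seen r} {missing r} (proj₂ (size r)) (split r) few-r)
            (seen-product p∈j p∈k r∈k p≢r)

        seen₀ : seen j ≤ 1800 * z
        seen₀ = seen-bound (here refl) (there (here (sym (k⊕4⊕1 j)))) (here refl) (k≢k⊕4 j)
                           (≤-trans (m≤n+m (missing (j ⊕ 4)) (missing (j ⊕ 2) + missing (j ⊕ 3))) few)

        seen₁ : seen (j ⊕ 1) ≤ 1800 * z
        seen₁ = seen-bound (there (here refl)) (here refl) (there (here (sym (k⊕1⊕1 j)))) (k⊕1≢k⊕2 j)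
                           (≤-trans (≤-trans (m≤m+n (missing (j ⊕ 2)) (missing (j ⊕ 3)))
                                             (m≤m+n (missing (j ⊕ 2) + missing (j ⊕ 3)) (missing (j ⊕ 4)))) few)

        many : ∀ {p} → seen p ≤ 1800 * z → h < missing p
        many {p} seen-p = many-missing {n} {h} {s} {t} large {count (inV p)} {seen p} {missing p} {z}
                                       (proj₂ (size p)) (split p) seen-p z≤

        near-adjacent : ∀ w → inIdx (ℓ w) (near (j ⊕ 3)) ≡ true → adj G u w ≡ true
        near-adjacent w w∈ with adj G u w in uw
        ... | true  = refl
        ... | false with inIdx⁻ (near (j ⊕ 3)) w∈
        ...   | _ , ℓw , here refl =
          ⊥-elim (≤⇒≯ (subst (λ k → missing k ≤ h) (k⊕3⊕4⊕3 j) (missing-far₃ ℓw uw)) (many seen₀))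
        ...   | _ , ℓw , there (here refl) =
          ⊥-elim (≤⇒≯ (subst (λ k → missing k ≤ h) (k⊕3⊕2 j) (missing-far₂ ℓw uw)) (many seen₀))
        ...   | _ , ℓw , there (there (here refl)) =
          ⊥-elim (≤⇒≯ (subst (λ k → missing k ≤ h) (k⊕3⊕1⊕2 j) (missing-far₂ ℓw uw)) (many seen₁))

        far-few : count (λ w → inIdx (ℓ w) (far (j ⊕ 3)) ∧ adj G u w) ≤ 3600 * (h + h + t)
        far-few = begin
          count (λ w → inIdx (ℓ w) (far (j ⊕ 3)) ∧ adj G u w) ≤⟨ count-cover₂ cover ⟩
          seen j + seen (j ⊕ 1)                               ≤⟨ +-mono-≤ seen₀ seen₁ ⟩
          1800 * z + 1800 * z                                 ≡⟨ double z ⟩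
          3600 * z                                            ≤⟨ *-monoʳ-≤ 3600 z≤ ⟩
          3600 * (h + h + t)                                  ∎
          where
          open ≤-Reasoning
          double : ∀ z → 1800 * z + 1800 * z ≡ 3600 * z
          double = solve-∀
          cover : ∀ w → (inIdx (ℓ w) (far (j ⊕ 3)) ∧ adj G u w) ≡ true →
                  (inV j w ∧ adj G u w) ≡ true ⊎ (inV (j ⊕ 1) w ∧ adj G u w) ≡ true
          cover w w∈ with inIdx⁻ (far (j ⊕ 3)) (∧-conicalˡ _ _ w∈)
          ... | _ , ℓw , here refl =
            inj₁ (cong₂ _∧_ (inV⁺ (trans ℓw (cong just (k⊕3⊕2 j)))) (∧-conicalʳ _ _ w∈))
          ... | _ , ℓw , there (here refl) =
            inj₂ (cong₂ _∧_ (inV⁺ (trans ℓw (cong just (k⊕3⊕3 j)))) (∧-conicalʳ _ _ w∈))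

      module _ (clique : CliqueCond G ℓ) (minimal : K4Minimizer G) {s t : ℕ}
               (size : SizeCond ℓ s) (few-U : USizeCond ℓ t) (large : 18005 * (h + s + t) + 10 ≤ n) where

        u-attaches : ∃ λ i → (∀ w → inIdx (ℓ w) (near i) ≡ true → adj G u w ≡ true)
                           × count (λ w → inIdx (ℓ w) (far i) ∧ adj G u w) ≤ 3600 * (h + h + t)
        u-attaches = j ⊕ 3 , near-adjacent , far-few
          where
          choice = five-cycle-choice h missing missing-dichotomy
          j = proj₁ choice
          open Attach clique minimal size few-U large j (proj₂ choice)

proposition4p7 :
    (G : (n : ℕ) → Graph n) → (part : (n : ℕ) → Fin n → Label) →
    (∀ n → AlphaAtMost2 (G n)) → (∀ n → K4Minimizer (G n)) →
    (Σ (ℕ → ℕ) λ h → LittleO h × (∀ n → DegreeCond (G n) (part n) (h n))) →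
    (∀ n → CliqueCond (G n) (part n)) →
    (Σ (ℕ → ℕ) λ s → LittleO s × (∀ n → SizeCond (part n) (s n))) →
    (Σ (ℕ → ℕ) λ t → LittleO t × (∀ n → USizeCond (part n) (t n))) →
    Σ (ℕ → ℕ) λ g → LittleO g × ∃ λ N → ∀ n → N ≤ n →
      ∀ (u : Fin n) → part n u ≡ nothing →
        ∃ λ (i : Fin 5) →
          (∀ (w : Fin n) → inIdx (part n w) (near i) ≡ true → adj (G n) u w ≡ true)
          × (count (λ w → inIdx (part n w) (far i) ∧ adj (G n) u w) ≤ g n)
proposition4p7 G part α≤2 minimal (h , h-o , degree) clique (s , s-o , size) (t , t-o , few-U) =
  g , LittleO-scale 3600 (LittleO-+ (LittleO-+ h-o h-o) t-o) , N , λ n N≤n u u∈U →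
    u-attaches (G n) (part n) u u∈U (α≤2 n) (degree n) (clique n) (minimal n) (size n) (few-U n) (large n N≤n)
  where
  g : ℕ → ℕ
  g n = 3600 * (h n + h n + t n)
  eventually = LittleO-eventually (LittleO-+ (LittleO-+ h-o s-o) t-o) 18005 10
  N = proj₁ eventually
  large = proj₂ eventually
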